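{- Let $\mathcal{H}'$ be an intersecting $6$-partite hypergraph with exactly $8$ edges and $\tau(\mathcal{H}') = 4$. Then $\mathcal{H}'$ has one of the following degree structures: (i) each of the $6$ parts contains one vertex of degree $3$, two vertices of degree $2$ and one vertex of degree $1$; or (ii) $5$ of the parts each contain one vertex of degree $3$, two vertices of degree $2$ and one vertex of degree $1$, and the remaining part contains one vertex of degree $3$, one vertex of degree $2$, and three vertices of degree $1$.
   Context: A hypergraph consists of a vertex set and a set of edges, each a nonempty subset of the vertex set. It is $6$-partite if its vertex set can be partitioned into $6$ parts such that every edge contains exactly one vertex from each part. It is intersecting if every two edges share at least one vertex. $\tau$ denotes the minimum size of a set of vertices meeting every edge. The degree of a vertex $v$ is the number of edges containing $v$. -}

module Defs where

open import Data.Nat using (ℕ)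
open import Data.Fin using (Fin; _≟_)
open import Data.Fin.Subset using (Subset; _∈_; _∩_; Nonempty; ∣_∣)
open import Data.Fin.Subset.Properties using (_∈?_)
open import Data.List using (List; length; filter; allFin)
open import Data.Product using (_×_; ∃; ∃-syntax; ∃!; _,_)
open import Data.Sum using (_⊎_)
open import Relation.Binary.PropositionalEquality using (_≡_; _≢_)
open import Relation.Nullary.Decidable using (_×-dec_)

Edges : ℕ → ℕ → Set
Edges n m = Fin m → Subset n

-- the m edges are pairwise distinct (the edge set has exactly m elements)
Distinct : ∀ {n m} → Edges n m → Set
Distinct {m = m} E = ∀ (i j : Fin m) → E i ≡ E j → i ≡ j

Intersecting : ∀ {n m} → Edges n m → Set
Intersecting {m = m} E = ∀ (i j : Fin m) → Nonempty (E i ∩ E j)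

IsKPartition : ∀ {n m} (k : ℕ) → Edges n m → (Fin n → Fin k) → Set
IsKPartition {n} {m} k E part =
  ∀ (i : Fin m) (p : Fin k) → ∃! _≡_ (λ (v : Fin n) → (v ∈ E i) × (part v ≡ p))

IsCover : ∀ {n m} → Edges n m → Subset n → Set
IsCover {m = m} E C = ∀ (i : Fin m) → Nonempty (E i ∩ C)

Tau≡ : ∀ {n m} → Edges n m → ℕ → Set
Tau≡ {n} E t =
  (∃[ C ] (IsCover E C × ∣ C ∣ ≡ t)) ×
  (∀ (C : Subset n) → IsCover E C → t Data.Nat.≤ ∣ C ∣)

degree : ∀ {n m} → Edges n m → Fin n → ℕ
degree {m = m} E v = length (filter (λ i → v ∈? E i) (allFin m))

countDeg : ∀ {n m k} → Edges n m → (Fin n → Fin k) → Fin k → ℕ → ℕ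
countDeg {n} E part p d =
  length (filter (λ v → (part v ≟ p) ×-dec (degree E v Data.Nat.≟ d)) (allFin n))

TypeA : ∀ {n m k} → Edges n m → (Fin n → Fin k) → Fin k → Set
TypeA E part p =
  (countDeg E part p 3 ≡ 1) × (countDeg E part p 2 ≡ 2) × (countDeg E part p 1 ≡ 1)

TypeB : ∀ {n m k} → Edges n m → (Fin n → Fin k) → Fin k → Set
TypeB E part p =
  (countDeg E part p 3 ≡ 1) × (countDeg E part p 2 ≡ 1) × (countDeg E part p 1 ≡ 3)

module Submission where

open import Defs
open import Data.Nat using (ℕ; zero; suc; _+_; _*_; _∸_; _≤_; _<_; z≤n; s≤s; _≡ᵇ_; _<ᵇ_; NonZero)
  renaming (_≟_ to _≟ℕ_)
open import Data.Nat.Properties hiding (_≟_)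
open import Data.Nat.Solver using (module +-*-Solver)
open import Data.Bool using (Bool; true; false; _∧_; _∨_; not; T)
open import Data.Bool.Properties using (∧-identityʳ; T-≡)
open import Function.Bundles using (Equivalence)
open import Data.Fin using (Fin; zero; suc; _≟_)
open import Data.Fin.Subset using (Subset; _∈_; _∪_; ⁅_⁆; ∣_∣; inside; outside)
open import Data.Fin.Subset.Properties using (_∈?_; x∈p∩q⁻; x∈p∩q⁺; x∈p∪q⁺; x∈⁅x⁆; ∣⁅x⁆∣≡1)
open import Data.List using (length; filter; tabulate)
open import Data.Vec using ([]; _∷_)
open import Data.Product using (_×_; _,_; ∃-syntax; proj₁; proj₂)
open import Data.Sum using (_⊎_; inj₁; inj₂) renaming (map to ⊎-map)
open import Data.Empty using (⊥; ⊥-elim)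
open import Relation.Nullary using (¬_; yes; no; Dec)
open import Relation.Nullary.Decidable using (⌊_⌋; _×-dec_)
open import Relation.Binary.PropositionalEquality
open import Algebra.Properties.CommutativeMonoid.Sum +-0-commutativeMonoid
  using (sum; ∑-distrib-+; ∑-comm; sum-cong-≗)
open import Algebra.Properties.Semiring.Sum +-*-semiring using (*-distribʳ-sum)
open +-*-Solver using (solve; _:+_; _:*_; _:=_; con)

-- Degree structure of an intersecting 6-partite hypergraph with 8 edges and
-- τ = 4.  The hypergraph is seen through its edges: (p , i) is the vertex of
-- edge i in part p, and module Configuration works only with the relation
-- "(p , i) lies on edge j".  After a small library of finite sums and counts:
--  * covers: two vertices miss ≥ 3 edges, so every degree is ≤ 3, two
--    vertices of degree 3 ("heavy") share an edge and a part has at most one;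
--  * local balance: an edge with w degree-1 and r heavy vertices meets at
--    least w + r + 1 and at most 2r further edges in heavy vertices;
--  * summing, with k heavy parts and S ≥ k degree-1 vertices, S + 3k + 8 ≤ 6k;
--    double counting pairs of heavy vertices yields an edge where the bound is
--    strict, leaving k = 6, S ≤ 9 or k = 5, S ≤ 6;
--  * k = 5 is refuted, and k = 6 with S ≤ 9 gives exactly the two profiles.

∧-elim : ∀ {a b} → a ∧ b ≡ true → a ≡ true × b ≡ true
∧-elim {true} {true} _ = refl , refl

∧-intro : ∀ {a b} → a ≡ true → b ≡ true → a ∧ b ≡ true
∧-intro refl refl = refl

∨-elim : ∀ {a b} → a ∨ b ≡ true → a ≡ true ⊎ b ≡ true
∨-elim {true} _ = inj₁ refl
∨-elim {false} e = inj₂ e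

not-elim : ∀ {a} → not a ≡ true → a ≡ false
not-elim {false} _ = refl

true≢false : ∀ {a} → a ≡ true → a ≡ false → ⊥
true≢false refl ()

bool-ext : ∀ {a b} → (a ≡ true → b ≡ true) → (b ≡ true → a ≡ true) → a ≡ b
bool-ext {true} {true} _ _ = refl
bool-ext {true} {false} f _ = sym (f refl)
bool-ext {false} {true} _ g = g refl
bool-ext {false} {false} _ _ = refl

dec-elim : ∀ {A : Set} (d : Dec A) → ⌊ d ⌋ ≡ true → A
dec-elim (yes a) _ = a

dec-intro : ∀ {A : Set} (d : Dec A) → A → ⌊ d ⌋ ≡ true
dec-intro (yes _) _ = refl
dec-intro (no ¬a) a = ⊥-elim (¬a a)

≡ᵇ-elim : ∀ {m n} → (m ≡ᵇ n) ≡ true → m ≡ n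
≡ᵇ-elim {m} {n} e = ≡ᵇ⇒≡ m n (Equivalence.from T-≡ e)

≡ᵇ-intro : ∀ {m n} → m ≡ n → (m ≡ᵇ n) ≡ true
≡ᵇ-intro {m} {n} e = Equivalence.to T-≡ (≡⇒≡ᵇ m n e)

_≢ᵇ_ : ∀ {m} → Fin m → Fin m → Bool
i ≢ᵇ a = not ⌊ i ≟ a ⌋

≢ᵇ-intro : ∀ {m} {i a : Fin m} → i ≢ a → (i ≢ᵇ a) ≡ true
≢ᵇ-intro {i = i} {a} i≢a with i ≟ a
... | yes i≡a = ⊥-elim (i≢a i≡a)
... | no _ = refl

≢ᵇ-elim : ∀ {m} {i a : Fin m} → (i ≢ᵇ a) ≡ true → i ≢ a
≢ᵇ-elim {i = i} {a} e with i ≟ a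
≢ᵇ-elim () | yes _
... | no i≢a = i≢a

-- (this holds definitionally only after inspecting  i ≟ a)
⌊≟⌋-suc : ∀ {m} (i a : Fin m) → ⌊ suc i ≟ suc a ⌋ ≡ ⌊ i ≟ a ⌋
⌊≟⌋-suc i a with i ≟ a
... | yes _ = refl
... | no _ = refl

-- A false inequality between numerals is refuted by evaluation: the
-- second argument is then  tt.
numeral-absurd : ∀ {m n} → m ≤ n → T (n <ᵇ m) → ⊥
numeral-absurd {m} {n} m≤n n<m = <⇒≱ (<ᵇ⇒< n m n<m) m≤n

𝟙 : Bool → ℕ
𝟙 true = 1
𝟙 false = 0

𝟙≤1 : ∀ b → 𝟙 b ≤ 1
𝟙≤1 true = ≤-refl
𝟙≤1 false = z≤n

-- They are the
-- library's sums, made opaque so that sums over the concrete index sets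
-- Fin 6 and Fin 8 are never unfolded by the type checker.
opaque
  ∑ : ∀ {m} → (Fin m → ℕ) → ℕ
  ∑ = sum

  ∑-zero : (f : Fin 0 → ℕ) → ∑ f ≡ 0
  ∑-zero f = refl

  ∑-suc : ∀ {m} (f : Fin (suc m) → ℕ) → ∑ f ≡ f zero + ∑ (λ i → f (suc i))
  ∑-suc f = refl

  ∑-cong : ∀ {m} {f g : Fin m → ℕ} → (∀ i → f i ≡ g i) → ∑ f ≡ ∑ g
  ∑-cong = sum-cong-≗

  ∑-+ : ∀ {m} (f g : Fin m → ℕ) → ∑ (λ i → f i + g i) ≡ ∑ f + ∑ g
  ∑-+ = ∑-distrib-+

  ∑-swap : ∀ {m k} (M : Fin m → Fin k → ℕ) → ∑ (λ i → ∑ (λ j → M i j)) ≡ ∑ (λ j → ∑ (λ i → M i j))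
  ∑-swap = ∑-comm

  ∑-+₃ : ∀ {m} (f g h : Fin m → ℕ) → ∑ (λ i → f i + g i + h i) ≡ ∑ f + ∑ g + ∑ h
  ∑-+₃ f g h = trans (∑-+ (λ i → f i + g i) h) (cong (_+ ∑ h) (∑-+ f g))

  ∑-*ʳ : ∀ {m} (f : Fin m → ℕ) c → ∑ (λ i → f i * c) ≡ ∑ f * c
  ∑-*ʳ f c = sym (*-distribʳ-sum c f)

  ∑-const : ∀ {m} c → ∑ {m} (λ _ → c) ≡ m * c
  ∑-const {zero} c = refl
  ∑-const {suc m} c = cong (c +_) (∑-const {m} c)

  ∑-mono : ∀ {m} {f g : Fin m → ℕ} → (∀ i → f i ≤ g i) → ∑ f ≤ ∑ g
  ∑-mono {zero} _ = z≤n
  ∑-mono {suc m} f≤g = +-mono-≤ (f≤g zero) (∑-mono (λ i → f≤g (suc i)))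

  ∑-mono-slack : ∀ {m} {f g : Fin m → ℕ} (a : Fin m) c →
    (∀ i → f i ≤ g i) → f a + c ≤ g a → ∑ f + c ≤ ∑ g
  ∑-mono-slack {suc m} {f} {g} zero c f≤g slack = begin
    f zero + ∑ (λ i → f (suc i)) + c   ≡⟨ +-assoc (f zero) _ c ⟩
    f zero + (∑ (λ i → f (suc i)) + c) ≡⟨ cong (f zero +_) (+-comm _ c) ⟩
    f zero + (c + ∑ (λ i → f (suc i))) ≡⟨ +-assoc (f zero) c _ ⟨
    f zero + c + ∑ (λ i → f (suc i))   ≤⟨ +-mono-≤ slack (∑-mono (λ i → f≤g (suc i))) ⟩
    g zero + ∑ (λ i → g (suc i))       ∎
    where open ≤-Reasoning
  ∑-mono-slack {suc m} {f} {g} (suc a) c f≤g slack = begin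
    f zero + ∑ (λ i → f (suc i)) + c   ≡⟨ +-assoc (f zero) _ c ⟩
    f zero + (∑ (λ i → f (suc i)) + c) ≤⟨ +-mono-≤ (f≤g zero) (∑-mono-slack a c (λ i → f≤g (suc i)) slack) ⟩
    g zero + ∑ (λ i → g (suc i))       ∎
    where open ≤-Reasoning

count : ∀ {m} → (Fin m → Bool) → ℕ
count f = ∑ (λ i → 𝟙 (f i))

count-suc : ∀ {m} (f : Fin (suc m) → Bool) → count f ≡ 𝟙 (f zero) + count (λ i → f (suc i))
count-suc f = ∑-suc (λ i → 𝟙 (f i))

count≤ : ∀ {m} (f : Fin m → Bool) → count f ≤ m
count≤ {zero} f = ≤-reflexive (∑-zero _)
count≤ {suc m} f rewrite count-suc f with f zero
... | true = s≤s (count≤ (λ i → f (suc i)))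
... | false = m≤n⇒m≤1+n (count≤ (λ i → f (suc i)))

count-mono : ∀ {m} {f g : Fin m → Bool} → (∀ i → f i ≡ true → g i ≡ true) → count f ≤ count g
count-mono {f = f} {g} f⇒g = ∑-mono pointwise
  where
  pointwise : ∀ i → 𝟙 (f i) ≤ 𝟙 (g i)
  pointwise i with f i | g i | f⇒g i
  ... | false | _ | _ = z≤n
  ... | true | true | _ = ≤-refl
  ... | true | false | h = ⊥-elim (true≢false (h refl) refl)

count-cong : ∀ {m} {f g : Fin m → Bool} → (∀ i → f i ≡ g i) → count f ≡ count g
count-cong f≗g = ∑-cong (λ i → cong 𝟙 (f≗g i))

count-none : ∀ {m} {f : Fin m → Bool} → (∀ i → f i ≡ false) → count f ≡ 0
count-none {m} none = trans (count-cong {g = λ _ → false} none) (trans (∑-const {m} 0) (*-zeroʳ m))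

count-witness : ∀ {m} (f : Fin m → Bool) → 1 ≤ count f → ∃[ i ] f i ≡ true
count-witness {zero} f pos with subst (1 ≤_) (∑-zero _) pos
... | ()
count-witness {suc m} f pos rewrite count-suc f with f zero in f0
... | true = zero , f0
... | false with count-witness (λ i → f (suc i)) pos
... | i , fi = suc i , fi

count-pos : ∀ {m} (f : Fin m → Bool) (i : Fin m) → f i ≡ true → 1 ≤ count f
count-pos f zero fi rewrite count-suc f | fi = s≤s z≤n
count-pos f (suc i) fi rewrite count-suc f = ≤-trans (count-pos (λ j → f (suc j)) i fi) (m≤n+m _ (𝟙 (f zero)))

count-zero⇒false : ∀ {m} (f : Fin m → Bool) → count f ≡ 0 → ∀ i → f i ≡ false
count-zero⇒false f none i with f i in fi
... | false = refl
... | true with subst (1 ≤_) none (count-pos f i fi)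
... | ()

count-all : ∀ {m} → count {m} (λ _ → true) ≡ m
count-all {zero} = ∑-zero _
count-all {suc m} = trans (count-suc {m} (λ _ → true)) (cong suc (count-all {m}))

count-single : ∀ {m} (a : Fin m) → count (λ i → ⌊ i ≟ a ⌋) ≡ 1
count-single {suc m} zero = trans (count-suc (λ i → ⌊ i ≟ zero ⌋)) (cong suc (count-none {m} (λ _ → refl)))
count-single (suc a) = trans (count-suc (λ i → ⌊ i ≟ suc a ⌋)) (trans (count-cong (λ i → ⌊≟⌋-suc i a)) (count-single a))

count-remove : ∀ {m} (f : Fin m → Bool) (a : Fin m) → f a ≡ true →
  count f ≡ suc (count (λ i → f i ∧ (i ≢ᵇ a)))
count-remove f a fa = begin
  count f                                                      ≡⟨ ∑-cong split ⟩
  ∑ (λ i → 𝟙 ⌊ i ≟ a ⌋ + 𝟙 (f i ∧ (i ≢ᵇ a)))                ≡⟨ ∑-+ (λ i → 𝟙 ⌊ i ≟ a ⌋) (λ i → 𝟙 (f i ∧ (i ≢ᵇ a))) ⟩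
  count (λ i → ⌊ i ≟ a ⌋) + count (λ i → f i ∧ (i ≢ᵇ a))      ≡⟨ cong (_+ count (λ i → f i ∧ (i ≢ᵇ a))) (count-single a) ⟩
  suc (count (λ i → f i ∧ (i ≢ᵇ a)))                          ∎
  where
  open ≡-Reasoning
  split : ∀ i → 𝟙 (f i) ≡ 𝟙 ⌊ i ≟ a ⌋ + 𝟙 (f i ∧ (i ≢ᵇ a))
  split i with i ≟ a
  ... | yes refl rewrite fa = refl
  ... | no _ = cong 𝟙 (sym (∧-identityʳ (f i)))

count-others : ∀ {m} (a : Fin (suc m)) → count (λ i → i ≢ᵇ a) ≡ m
count-others {m} a = suc-injective (trans (sym (count-remove (λ _ → true) a refl)) (count-all {suc m}))

count-compl : ∀ {m} (f : Fin m → Bool) → count f + count (λ i → not (f i)) ≡ m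
count-compl {m} f = begin
  count f + count (λ i → not (f i))   ≡⟨ ∑-+ (λ i → 𝟙 (f i)) (λ i → 𝟙 (not (f i))) ⟨
  ∑ (λ i → 𝟙 (f i) + 𝟙 (not (f i))) ≡⟨ ∑-cong (λ i → pointwise (f i)) ⟩
  count {m} (λ _ → true)              ≡⟨ count-all ⟩
  m                                   ∎
  where
  open ≡-Reasoning
  pointwise : ∀ b → 𝟙 b + 𝟙 (not b) ≡ 1
  pointwise true = refl
  pointwise false = refl

count-∨ : ∀ {m} (f g : Fin m → Bool) →
  count (λ i → f i ∨ g i) + count (λ i → f i ∧ g i) ≡ count f + count g
count-∨ f g = begin
  count (λ i → f i ∨ g i) + count (λ i → f i ∧ g i)   ≡⟨ ∑-+ (λ i → 𝟙 (f i ∨ g i)) (λ i → 𝟙 (f i ∧ g i)) ⟨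
  ∑ (λ i → 𝟙 (f i ∨ g i) + 𝟙 (f i ∧ g i))          ≡⟨ ∑-cong (λ i → pointwise (f i) (g i)) ⟩
  ∑ (λ i → 𝟙 (f i) + 𝟙 (g i))                      ≡⟨ ∑-+ (λ i → 𝟙 (f i)) (λ i → 𝟙 (g i)) ⟩
  count f + count g                                   ∎
  where
  open ≡-Reasoning
  pointwise : ∀ a b → 𝟙 (a ∨ b) + 𝟙 (a ∧ b) ≡ 𝟙 a + 𝟙 b
  pointwise true true = refl
  pointwise true false = refl
  pointwise false b = +-identityʳ (𝟙 b)

keep-other : ∀ {m} {b : Bool} {a j : Fin m} → b ≡ true → j ≢ a → (b ∧ (j ≢ᵇ a)) ≡ true
keep-other fj j≢a = ∧-intro fj (≢ᵇ-intro j≢a)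

count≥suc : ∀ {m} (f : Fin m → Bool) (a : Fin m) {k} → f a ≡ true →
  k ≤ count (λ i → f i ∧ (i ≢ᵇ a)) → suc k ≤ count f
count≥suc f a fa k≤ = subst (_ ≤_) (sym (count-remove f a fa)) (s≤s k≤)

count≥2 : ∀ {m} (f : Fin m → Bool) (a b : Fin m) → f a ≡ true → f b ≡ true → a ≢ b → 2 ≤ count f
count≥2 f a b fa fb a≢b = count≥suc f a fa (count-pos (λ i → f i ∧ (i ≢ᵇ a)) b (keep-other fb (≢-sym a≢b)))

count≥4 : ∀ {m} (f : Fin m → Bool) (a b c e : Fin m) →
  f a ≡ true → f b ≡ true → f c ≡ true → f e ≡ true →
  a ≢ b → a ≢ c → a ≢ e → b ≢ c → b ≢ e → c ≢ e → 4 ≤ count f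
count≥4 f a b c e fa fb fc fe ab ac ae bc be ce =
  count≥suc f a fa (count≥suc (λ i → f i ∧ (i ≢ᵇ a)) b (keep-other fb (≢-sym ab))
    (count≥2 (λ i → (f i ∧ (i ≢ᵇ a)) ∧ (i ≢ᵇ b)) c e
      (keep-other (keep-other fc (≢-sym ac)) (≢-sym bc)) (keep-other (keep-other fe (≢-sym ae)) (≢-sym be)) ce))

count-remove≤ : ∀ {m k} (f : Fin m → Bool) (a : Fin m) → f a ≡ true →
  count f ≤ suc k → count (λ i → f i ∧ (i ≢ᵇ a)) ≤ k
count-remove≤ f a fa bound = ≤-pred (subst (_≤ _) (count-remove f a fa) bound)

count-remove≥ : ∀ {m k} (f : Fin m → Bool) (a : Fin m) → f a ≡ true →
  suc k ≤ count f → k ≤ count (λ i → f i ∧ (i ≢ᵇ a))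
count-remove≥ f a fa bound = ≤-pred (subst (_ ≤_) (count-remove f a fa) bound)

count≤1⇒single : ∀ {m} (f : Fin (suc m) → Bool) → count f ≤ 1 →
  ∃[ a ] (∀ j → f j ≡ true → j ≡ a)
count≤1⇒single f bound with 1 ≤? count f
... | no empty = zero , λ j fj → ⊥-elim (empty (count-pos f j fj))
... | yes pos with count-witness f pos
... | a , fa = a , only-a
  where
  others-empty : count (λ i → f i ∧ (i ≢ᵇ a)) ≡ 0
  others-empty = n≤0⇒n≡0 (count-remove≤ f a fa bound)
  only-a : ∀ j → f j ≡ true → j ≡ a
  only-a j fj with j ≟ a
  ... | yes j≡a = j≡a
  ... | no j≢a = ⊥-elim (true≢false (keep-other fj j≢a) (count-zero⇒false (λ i → f i ∧ (i ≢ᵇ a)) others-empty j))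

count≤2⇒pair : ∀ {m} (f : Fin (suc m) → Bool) → count f ≤ 2 →
  ∃[ a ] ∃[ b ] (∀ j → f j ≡ true → j ≡ a ⊎ j ≡ b)
count≤2⇒pair f bound with 1 ≤? count f
... | no empty = zero , zero , λ j fj → ⊥-elim (empty (count-pos f j fj))
... | yes pos with count-witness f pos
... | a , fa with count≤1⇒single (λ i → f i ∧ (i ≢ᵇ a)) (count-remove≤ f a fa bound)
... | b , only-b = a , b , a-or-b
  where
  a-or-b : ∀ j → f j ≡ true → j ≡ a ⊎ j ≡ b
  a-or-b j fj with j ≟ a
  ... | yes j≡a = inj₁ j≡a
  ... | no j≢a = inj₂ (only-b j (keep-other fj j≢a))

-- A decidable property of Fin m holds everywhere or fails somewhere (by
-- direct recursion: the library's all? would be unfolded at concrete sizes).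
all-or-counterexample : ∀ {m} (P : Fin m → Set) → (∀ i → Dec (P i)) → (∀ i → P i) ⊎ ∃[ i ] ¬ P i
all-or-counterexample {zero} P P? = inj₁ λ ()
all-or-counterexample {suc m} P P? with P? zero
... | no ¬p0 = inj₂ (zero , ¬p0)
... | yes p0 with all-or-counterexample (λ i → P (suc i)) (λ i → P? (suc i))
... | inj₁ all = inj₁ λ { zero → p0 ; (suc i) → all i }
... | inj₂ (i , ¬pi) = inj₂ (suc i , ¬pi)

count≥3⇒three : ∀ {m} (f : Fin m → Bool) → 3 ≤ count f →
  ∃[ a ] ∃[ b ] ∃[ c ] (f a ≡ true × f b ≡ true × f c ≡ true × a ≢ b × a ≢ c × b ≢ c)
count≥3⇒three f ≥3 with count-witness f (≤-trans (s≤s z≤n) ≥3)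
... | a , fa with count-witness (λ i → f i ∧ (i ≢ᵇ a)) (≤-trans (s≤s z≤n) (count-remove≥ f a fa ≥3))
... | b , fb′ with count-witness (λ i → (f i ∧ (i ≢ᵇ a)) ∧ (i ≢ᵇ b))
                     (count-remove≥ (λ i → f i ∧ (i ≢ᵇ a)) b fb′ (count-remove≥ f a fa ≥3))
... | c , fc″ with ∧-elim fb′ | ∧-elim fc″
... | fb , b≢ᵇa | fc′ , c≢ᵇb with ∧-elim fc′
... | fc , c≢ᵇa = a , b , c , fa , fb , fc , ≢-sym (≢ᵇ-elim b≢ᵇa) , ≢-sym (≢ᵇ-elim c≢ᵇa) , ≢-sym (≢ᵇ-elim c≢ᵇb)

∑-delta : ∀ {m} (a : Fin m) (h : Fin m → ℕ) → ∑ (λ v → 𝟙 ⌊ a ≟ v ⌋ * h v) ≡ h a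
∑-delta a h = begin
  ∑ (λ v → 𝟙 ⌊ a ≟ v ⌋ * h v)   ≡⟨ ∑-cong move ⟩
  ∑ (λ v → 𝟙 ⌊ v ≟ a ⌋ * h a)   ≡⟨ ∑-*ʳ (λ v → 𝟙 ⌊ v ≟ a ⌋) (h a) ⟩
  count (λ v → ⌊ v ≟ a ⌋) * h a ≡⟨ cong (_* h a) (count-single a) ⟩
  1 * h a                       ≡⟨ +-identityʳ (h a) ⟩
  h a                           ∎
  where
  open ≡-Reasoning
  move : ∀ v → 𝟙 ⌊ a ≟ v ⌋ * h v ≡ 𝟙 ⌊ v ≟ a ⌋ * h a
  move v with a ≟ v | v ≟ a
  ... | yes refl | yes _ = refl
  ... | yes refl | no v≢v = ⊥-elim (v≢v refl)
  ... | no a≢v | yes v≡a = ⊥-elim (a≢v (sym v≡a))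
  ... | no _ | no _ = refl

-- Slack at two distinct points adds up (move the slack at b into f first).
∑-mono-slack₂ : ∀ {m} {f g : Fin m → ℕ} (a b : Fin m) c e → a ≢ b →
  (∀ i → f i ≤ g i) → f a + c ≤ g a → f b + e ≤ g b → ∑ f + c + e ≤ ∑ g
∑-mono-slack₂ {f = f} {g} a b c e a≢b f≤g slack-a slack-b = begin
  ∑ f + c + e                  ≡⟨ +-assoc (∑ f) c e ⟩
  ∑ f + (c + e)                ≡⟨ cong (∑ f +_) (+-comm c e) ⟩
  ∑ f + (e + c)                ≡⟨ +-assoc (∑ f) e c ⟨
  ∑ f + e + c                  ≡⟨ cong (λ z → ∑ f + z + c) (∑-delta b (λ _ → e)) ⟨
  ∑ f + ∑ bump + c             ≡⟨ cong (_+ c) (∑-+ f bump) ⟨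
  ∑ (λ i → f i + bump i) + c   ≤⟨ ∑-mono-slack a c bumped slack-a′ ⟩
  ∑ g                          ∎
  where
  open ≤-Reasoning
  bump : Fin _ → ℕ
  bump i = 𝟙 ⌊ b ≟ i ⌋ * e
  slack-a′ : f a + bump a + c ≤ g a
  slack-a′ with b ≟ a
  ... | yes b≡a = ⊥-elim (a≢b (sym b≡a))
  ... | no _ = subst (λ z → z + c ≤ g a) (sym (+-identityʳ (f a))) slack-a
  bumped : ∀ i → f i + bump i ≤ g i
  bumped i with b ≟ i
  ... | yes refl = subst (_≤ g i) (cong (f i +_) (sym (+-identityʳ e))) slack-b
  ... | no _ = subst (_≤ g i) (sym (+-identityʳ (f i))) (f≤g i)

length-filter-tabulate : ∀ {A : Set} {P : A → Set} (P? : ∀ x → Dec (P x)) {m} (g : Fin m → A) →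
  length (filter P? (tabulate g)) ≡ count (λ i → ⌊ P? (g i) ⌋)
length-filter-tabulate P? {zero} g = sym (∑-zero _)
length-filter-tabulate P? {suc m} g = begin
  length (filter P? (tabulate g))                                        ≡⟨ head-step ⟩
  𝟙 ⌊ P? (g zero) ⌋ + length (filter P? (tabulate (λ i → g (suc i))))   ≡⟨ cong (𝟙 ⌊ P? (g zero) ⌋ +_) (length-filter-tabulate P? (λ i → g (suc i))) ⟩
  𝟙 ⌊ P? (g zero) ⌋ + count (λ i → ⌊ P? (g (suc i)) ⌋)                  ≡⟨ count-suc (λ i → ⌊ P? (g i) ⌋) ⟨
  count (λ i → ⌊ P? (g i) ⌋)                                             ∎
  where
  open ≡-Reasoning
  head-step : length (filter P? (tabulate g)) ≡ 𝟙 ⌊ P? (g zero) ⌋ + length (filter P? (tabulate (λ i → g (suc i))))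
  head-step with P? (g zero)
  ... | yes _ = refl
  ... | no _ = refl

-- An intersecting 6-partite hypergraph with 8 edges and τ = 4, seen from
-- its edges: the vertex (p , i) is the vertex of edge i in part p, and
-- meet p i j says that it also lies on edge j.
module Configuration
  (meet : Fin 6 → Fin 8 → Fin 8 → Bool)
  (meet-refl : ∀ p i → meet p i i ≡ true)
  (meet-sym : ∀ p i j → meet p i j ≡ true → meet p j i ≡ true)
  (meet-trans : ∀ p i j l → meet p i j ≡ true → meet p j l ≡ true → meet p i l ≡ true)
  (intersecting : ∀ i j → ∃[ p ] meet p i j ≡ true)
  (no-3-cover : ∀ p₁ i₁ p₂ i₂ p₃ i₃ → ¬ (∀ j → (meet p₁ i₁ j ∨ meet p₂ i₂ j ∨ meet p₃ i₃ j) ≡ true))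
  -- the edges through degree-2 vertices of a part come in pairs
  (deg2-even : ∀ p → ∃[ c ] count (λ i → count (meet p i) ≡ᵇ 2) ≡ c * 2)
  where

  deg : Fin 6 → Fin 8 → ℕ
  deg p i = count (meet p i)

  pair-covered : ∀ a b → ∃[ p ] ∃[ i ] (∀ j → j ≡ a ⊎ j ≡ b → meet p i j ≡ true)
  pair-covered a b with intersecting a b
  ... | p , pab = p , a , λ { j (inj₁ refl) → meet-refl p a ; j (inj₂ refl) → pab }

  -- Two vertices leave at least three edges uncovered: the at most two
  -- uncovered edges would share a third vertex, giving a 3-cover.
  no-2-cover : ∀ p₁ i₁ p₂ i₂ → ¬ (count (λ j → not (meet p₁ i₁ j ∨ meet p₂ i₂ j)) ≤ 2)
  no-2-cover p₁ i₁ p₂ i₂ few with count≤2⇒pair (λ j → not (meet p₁ i₁ j ∨ meet p₂ i₂ j)) few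
  ... | a , b , in-pair with pair-covered a b
  ... | p , i , covers-pair = no-3-cover p₁ i₁ p₂ i₂ p i cover
    where
    cover : ∀ j → (meet p₁ i₁ j ∨ meet p₂ i₂ j ∨ meet p i j) ≡ true
    cover j with meet p₁ i₁ j in e₁ | meet p₂ i₂ j in e₂
    ... | true | _ = refl
    ... | false | true = refl
    ... | false | false = covers-pair j (in-pair j (cong₂ (λ x y → not (x ∨ y)) e₁ e₂))

  missed : Fin 6 → Fin 8 → Fin 8 → Bool
  missed p i j = not (meet p i j)

  -- Every vertex misses at least five edges.  Otherwise pick two missed
  -- edges a, b and a common vertex (q , a) of them: the two vertices
  -- (p , i) and (q , a) then miss at most two edges.
  misses-five : ∀ p i → ¬ (count (missed p i) ≤ 4)
  misses-five p i few with count (missed p i) ≤? 2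
  ... | yes ≤2 = no-2-cover p i p i (≤-trans (count-mono missed-by-both) ≤2)
    where
    missed-by-both : ∀ j → not (meet p i j ∨ meet p i j) ≡ true → missed p i j ≡ true
    missed-by-both j e with meet p i j
    ... | false = refl
  ... | no >2 with count-witness (missed p i) (≤-trans (s≤s z≤n) (≰⇒> >2))
  ... | a , missed-a with count-witness (λ j → missed p i j ∧ (j ≢ᵇ a))
                            (≤-trans (s≤s z≤n) (count-remove≥ (missed p i) a missed-a (≰⇒> >2)))
  ... | b , missed-b with intersecting a b
  ... | q , qab = no-2-cover p i q a (≤-trans (count-mono missed-by-both) rest≤2)
    where
    rest = λ j → (missed p i j ∧ (j ≢ᵇ a)) ∧ (j ≢ᵇ b)
    rest≤2 : count rest ≤ 2
    rest≤2 = count-remove≤ (λ j → missed p i j ∧ (j ≢ᵇ a)) b missed-b (count-remove≤ (missed p i) a missed-a few)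
    missed-by-both : ∀ j → not (meet p i j ∨ meet q a j) ≡ true → rest j ≡ true
    missed-by-both j e with meet p i j | meet q a j in qaj
    ... | false | false = keep-other (keep-other refl j≢a) j≢b
      where
      j≢a : j ≢ a
      j≢a refl = true≢false (meet-refl q a) qaj
      j≢b : j ≢ b
      j≢b refl = true≢false qab qaj

  deg+missed : ∀ p i → deg p i + count (missed p i) ≡ 8
  deg+missed p i = count-compl (meet p i)

  deg≤3 : ∀ p i → deg p i ≤ 3
  deg≤3 p i with deg p i ≤? 3
  ... | yes ≤3 = ≤3
  ... | no >3 = ⊥-elim (misses-five p i (+-cancelˡ-≤ 4 _ _ (begin
      4 + count (missed p i)       ≤⟨ +-monoˡ-≤ _ (≰⇒> >3) ⟩
      deg p i + count (missed p i) ≡⟨ deg+missed p i ⟩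
      8                            ∎)))
    where open ≤-Reasoning

  deg≥1 : ∀ p i → 1 ≤ deg p i
  deg≥1 p i = count-pos (meet p i) i (meet-refl p i)

  -- Two vertices of degree 3 share an edge: otherwise they would cover six
  -- edges and miss only two.
  deg3-meet : ∀ p i q j → deg p i ≡ 3 → deg q j ≡ 3 → ∃[ x ] (meet p i x ≡ true × meet q j x ≡ true)
  deg3-meet p i q j d₁ d₂ with count (λ x → meet p i x ∧ meet q j x) in common
  ... | suc _ with count-witness (λ x → meet p i x ∧ meet q j x) (subst (1 ≤_) (sym common) (s≤s z≤n))
  ... | x , both = x , ∧-elim both
  deg3-meet p i q j d₁ d₂ | zero = ⊥-elim (no-2-cover p i q j (≤-reflexive (+-cancelˡ-≡ 6 _ _ (begin
      6 + count missed-both                 ≡⟨ cong (_+ count missed-both) union ⟨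
      count covered + count missed-both     ≡⟨ count-compl covered ⟩
      8                                     ≡⟨⟩
      6 + 2                                 ∎))))
    where
    open ≡-Reasoning
    covered = λ x → meet p i x ∨ meet q j x
    missed-both = λ x → not (covered x)
    union : count covered ≡ 6
    union = begin
      count covered                                          ≡⟨ +-identityʳ _ ⟨
      count covered + 0                                      ≡⟨ cong (count covered +_) common ⟨
      count covered + count (λ x → meet p i x ∧ meet q j x)  ≡⟨ count-∨ (meet p i) (meet q j) ⟩
      deg p i + deg q j                                      ≡⟨ cong₂ _+_ d₁ d₂ ⟩
      6                                                      ∎

  meet-same-edges : ∀ p i j → meet p i j ≡ true → ∀ x → meet p i x ≡ meet p j x
  meet-same-edges p i j e x =
    bool-ext (meet-trans p j i x (meet-sym p i j e)) (meet-trans p i j x e)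

  meet-same-deg : ∀ p i j → meet p i j ≡ true → deg p i ≡ deg p j
  meet-same-deg p i j e = count-cong (meet-same-edges p i j e)

  heavy : Fin 6 → Fin 8 → Bool
  heavy p i = deg p i ≡ᵇ 3

  heavy-deg : ∀ {p i} → heavy p i ≡ true → deg p i ≡ 3
  heavy-deg = ≡ᵇ-elim

  heavy-move : ∀ p i j → heavy p i ≡ true → meet p i j ≡ true → heavy p j ≡ true
  heavy-move p i j hi e = ≡ᵇ-intro (trans (sym (meet-same-deg p i j e)) (heavy-deg hi))

  -- A part contains at most one heavy vertex: two heavy vertices share an
  -- edge, and an edge has only one vertex in each part.
  heavy-unique : ∀ p a b → heavy p a ≡ true → heavy p b ≡ true → meet p a b ≡ true
  heavy-unique p a b ha hb with deg3-meet p a p b (heavy-deg ha) (heavy-deg hb)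
  ... | x , ax , bx = meet-trans p a x b ax (meet-sym p b x bx)

  incid : ℕ → Fin 6 → ℕ
  incid k p = count (λ i → deg p i ≡ᵇ k)

  incid3-cases : ∀ p → incid 3 p ≡ 0 ⊎ incid 3 p ≡ 3
  incid3-cases p with incid 3 p in e
  ... | zero = inj₁ refl
  ... | suc _ with count-witness (heavy p) (subst (1 ≤_) (sym e) (s≤s z≤n))
  ... | i , hi = inj₂ (trans (sym e) (trans (count-cong heavy≡meet) (heavy-deg hi)))
    where
    heavy≡meet : ∀ j → heavy p j ≡ meet p i j
    heavy≡meet j = bool-ext (heavy-unique p i j hi) (heavy-move p i j hi)

  one-of-123 : ∀ v → 1 ≤ v → v ≤ 3 → 𝟙 (v ≡ᵇ 1) + 𝟙 (v ≡ᵇ 2) + 𝟙 (v ≡ᵇ 3) ≡ 1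
  one-of-123 1 _ _ = refl
  one-of-123 2 _ _ = refl
  one-of-123 3 _ _ = refl
  one-of-123 (suc (suc (suc (suc v)))) _ (s≤s (s≤s (s≤s ())))

  count-degrees : ∀ {m} (v : Fin m → Fin 6 × Fin 8) →
    let d = λ x → deg (proj₁ (v x)) (proj₂ (v x)) in
    count (λ x → d x ≡ᵇ 1) + count (λ x → d x ≡ᵇ 2) + count (λ x → d x ≡ᵇ 3) ≡ m
  count-degrees {m} v = begin
    count (λ x → d x ≡ᵇ 1) + count (λ x → d x ≡ᵇ 2) + count (λ x → d x ≡ᵇ 3)
      ≡⟨ ∑-+₃ (λ x → 𝟙 (d x ≡ᵇ 1)) (λ x → 𝟙 (d x ≡ᵇ 2)) (λ x → 𝟙 (d x ≡ᵇ 3)) ⟨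
    ∑ (λ x → 𝟙 (d x ≡ᵇ 1) + 𝟙 (d x ≡ᵇ 2) + 𝟙 (d x ≡ᵇ 3))
      ≡⟨ ∑-cong (λ x → one-of-123 (d x) (deg≥1 (proj₁ (v x)) (proj₂ (v x))) (deg≤3 (proj₁ (v x)) (proj₂ (v x)))) ⟩
    count {m} (λ _ → true)
      ≡⟨ count-all ⟩
    m ∎
    where
    open ≡-Reasoning
    d = λ x → deg (proj₁ (v x)) (proj₂ (v x))

  incid-total : ∀ p → incid 1 p + incid 2 p + incid 3 p ≡ 8
  incid-total p = count-degrees (λ i → p , i)

  onEdge : ℕ → Fin 8 → ℕ
  onEdge k g = count (λ p → deg p g ≡ᵇ k)

  edge-total : ∀ g → onEdge 1 g + onEdge 2 g + onEdge 3 g ≡ 6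
  edge-total g = count-degrees (λ p → p , g)

  via : Fin 8 → Fin 6 → Fin 8 → Bool
  via x p j = heavy p x ∧ meet p x j ∧ (j ≢ᵇ x)

  via-elim : ∀ {x p j} → via x p j ≡ true → heavy p x ≡ true × meet p x j ≡ true × j ≢ x
  via-elim {x} {p} {j} v with ∧-elim {heavy p x} v
  ... | hx , rest with ∧-elim {meet p x j} rest
  ... | xj , j≢ᵇx = hx , xj , ≢ᵇ-elim j≢ᵇx

  shared : Fin 8 → Fin 8 → ℕ
  shared x j = count (λ p → via x p j)

  heavyNbr : Fin 8 → Fin 8 → Bool
  heavyNbr x j = not (shared x j ≡ᵇ 0)

  heavyNbr-intro : ∀ x p j → via x p j ≡ true → heavyNbr x j ≡ true
  heavyNbr-intro x p j v with shared x j | count-pos (λ q → via x q j) p v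
  ... | suc _ | _ = refl

  heavyNbr-elim : ∀ x j → heavyNbr x j ≡ true → ∃[ p ] via x p j ≡ true
  heavyNbr-elim x j e with shared x j in s
  ... | suc _ = count-witness (λ q → via x q j) (subst (1 ≤_) (sym s) (s≤s z≤n))

  nbrs : Fin 8 → ℕ
  nbrs x = count (heavyNbr x)

  nbrs≤7 : ∀ x → nbrs x ≤ 7
  nbrs≤7 x = ≤-trans (count-mono (λ j e → ≢ᵇ-intro (proj₂ (proj₂ (via-elim (proj₂ (heavyNbr-elim x j e)))))))
                      (≤-reflexive (count-others x))

  via-count : ∀ x p → count (via x p) ≡ 𝟙 (heavy p x) * 2
  via-count x p with heavy p x in hx
  ... | false = count-none {8} (λ _ → refl)
  ... | true = suc-injective (begin
      suc (count (λ j → meet p x j ∧ (j ≢ᵇ x))) ≡⟨ count-remove (meet p x) x (meet-refl p x) ⟨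
      deg p x                                   ≡⟨ heavy-deg hx ⟩
      3                                         ∎)
    where open ≡-Reasoning

  shared-total : ∀ x → ∑ (shared x) ≡ onEdge 3 x * 2
  shared-total x = begin
    ∑ (λ j → count (λ p → via x p j))   ≡⟨ ∑-swap (λ j p → 𝟙 (via x p j)) ⟩
    ∑ (λ p → count (via x p))           ≡⟨ ∑-cong (via-count x) ⟩
    ∑ (λ p → 𝟙 (heavy p x) * 2)         ≡⟨ ∑-*ʳ (λ p → 𝟙 (heavy p x)) 2 ⟩
    onEdge 3 x * 2                        ∎
    where open ≡-Reasoning

  𝟙≤shared : ∀ x j → 𝟙 (heavyNbr x j) ≤ shared x j
  𝟙≤shared x j with shared x j
  ... | zero = z≤n
  ... | suc _ = s≤s z≤n

  nbrs≤ : ∀ x → nbrs x ≤ onEdge 3 x * 2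
  nbrs≤ x = ≤-trans (∑-mono (𝟙≤shared x)) (≤-reflexive (shared-total x))

  Crowded : Fin 8 → Set
  Crowded x = ∃[ y ] ∃[ p ] ∃[ q ] (p ≢ q × via x p y ≡ true × via x q y ≡ true)

  crowded⇒nbrs< : ∀ x → Crowded x → nbrs x < onEdge 3 x * 2
  crowded⇒nbrs< x (y , p , q , p≢q , vp , vq) = begin
    suc (nbrs x)                                   ≡⟨ +-comm 1 (nbrs x) ⟩
    nbrs x + 1                                     ≡⟨ cong (nbrs x +_) (count-single y) ⟨
    nbrs x + count (λ j → ⌊ j ≟ y ⌋)               ≡⟨ ∑-+ (λ j → 𝟙 (heavyNbr x j)) (λ j → 𝟙 ⌊ j ≟ y ⌋) ⟨
    ∑ (λ j → 𝟙 (heavyNbr x j) + 𝟙 ⌊ j ≟ y ⌋)     ≤⟨ ∑-mono bound ⟩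
    ∑ (shared x)                                 ≡⟨ shared-total x ⟩
    onEdge 3 x * 2                                 ∎
    where
    open ≤-Reasoning
    bound : ∀ j → 𝟙 (heavyNbr x j) + 𝟙 ⌊ j ≟ y ⌋ ≤ shared x j
    bound j with j ≟ y
    ... | no _ = ≤-trans (≤-reflexive (+-identityʳ _)) (𝟙≤shared x j)
    ... | yes refl = ≤-trans (+-monoˡ-≤ 1 (𝟙≤1 (heavyNbr x j))) (count≥2 (λ s → via x s j) p q vp vq p≢q)

  nbrs<⇒crowded : ∀ x → nbrs x < onEdge 3 x * 2 → Crowded x
  nbrs<⇒crowded x lt with all-or-counterexample (λ j → shared x j ≤ 1) (λ j → shared x j ≤? 1)
  ... | inj₁ all≤1 = ⊥-elim (<-irrefl refl (<-≤-trans lt (begin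
      onEdge 3 x * 2          ≡⟨ shared-total x ⟨
      ∑ (shared x)          ≤⟨ ∑-mono (λ j → at-most-one (all≤1 j)) ⟩
      nbrs x                  ∎)))
    where
    open ≤-Reasoning
    at-most-one : ∀ {j} → shared x j ≤ 1 → shared x j ≤ 𝟙 (heavyNbr x j)
    at-most-one {j} ≤1 with shared x j
    ... | zero = z≤n
    ... | suc zero = ≤-refl
    at-most-one (s≤s ()) | suc (suc _)
  ... | inj₂ (y , ≥2) with count-witness (λ s → via x s y) (≤-trans (s≤s z≤n) (≰⇒> ≥2))
  ... | p , vp with count-witness (λ s → via x s y ∧ (s ≢ᵇ p))
                     (≤-trans (s≤s z≤n) (count-remove≥ (λ s → via x s y) p vp (≰⇒> ≥2)))
  ... | q , vq′ with ∧-elim vq′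
  ... | vq , q≢ᵇp = y , p , q , (λ p≡q → ≢ᵇ-elim q≢ᵇp (sym p≡q)) , vp , vq

  via2 : Fin 8 → Fin 8 → Fin 6 → Bool
  via2 x j p = (deg p x ≡ᵇ 2) ∧ meet p x j ∧ (j ≢ᵇ x)

  light : Fin 8 → Fin 8 → Bool
  light x j = (j ≢ᵇ x) ∧ not (heavyNbr x j)

  -- A light edge meets x (the hypergraph is intersecting) in a vertex of
  -- degree at least 2 which is not heavy, hence of degree exactly 2.
  light⇒via2 : ∀ x j → light x j ≡ true → 1 ≤ count (via2 x j)
  light⇒via2 x j lj with ∧-elim lj | intersecting x j
  ... | j≢ᵇx , not-nbr | p , xj = count-pos (via2 x j) p (∧-intro (≡ᵇ-intro deg2) (∧-intro xj j≢ᵇx))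
    where
    not-heavy : heavy p x ≡ false
    not-heavy with heavy p x in hx
    ... | false = refl
    ... | true = ⊥-elim (true≢false (heavyNbr-intro x p j (∧-intro hx (∧-intro xj j≢ᵇx))) (not-elim not-nbr))
    deg≥2 : 2 ≤ deg p x
    deg≥2 = count≥2 (meet p x) x j (meet-refl p x) xj (λ x≡j → ≢ᵇ-elim j≢ᵇx (sym x≡j))
    deg2 : deg p x ≡ 2
    deg2 with deg p x | deg≥2 | deg≤3 p x | not-heavy
    ... | 1 | s≤s () | _ | _
    ... | 2 | _ | _ | _ = refl
    ... | 3 | _ | _ | ()
    ... | suc (suc (suc (suc _))) | _ | s≤s (s≤s (s≤s ())) | _

  via2-count : ∀ x p → count (λ j → via2 x j p) ≤ 𝟙 (deg p x ≡ᵇ 2)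
  via2-count x p with deg p x ≡ᵇ 2 in d2
  ... | false = ≤-reflexive (count-none {8} (λ _ → refl))
  ... | true = ≤-reflexive (suc-injective (trans (sym (count-remove (meet p x) x (meet-refl p x))) (≡ᵇ-elim d2)))

  light-count : ∀ x → count (light x) ≤ onEdge 2 x
  light-count x = begin
    count (light x)                        ≤⟨ ∑-mono light≤ ⟩
    ∑ (λ j → count (via2 x j))           ≡⟨ ∑-swap (λ j p → 𝟙 (via2 x j p)) ⟩
    ∑ (λ p → count (λ j → via2 x j p))   ≤⟨ ∑-mono (via2-count x) ⟩
    onEdge 2 x                             ∎
    where
    open ≤-Reasoning
    light≤ : ∀ j → 𝟙 (light x j) ≤ count (via2 x j)
    light≤ j with light x j in lj
    ... | false = z≤n
    ... | true = light⇒via2 x j lj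

  seven : ∀ x → 7 ≤ nbrs x + count (light x)
  seven x = begin
    7                                                ≡⟨ count-others x ⟨
    count (λ j → j ≢ᵇ x)                             ≤⟨ ∑-mono split ⟩
    ∑ (λ j → 𝟙 (heavyNbr x j) + 𝟙 (light x j))     ≡⟨ ∑-+ (λ j → 𝟙 (heavyNbr x j)) (λ j → 𝟙 (light x j)) ⟩
    nbrs x + count (light x)                         ∎
    where
    open ≤-Reasoning
    split : ∀ j → 𝟙 (j ≢ᵇ x) ≤ 𝟙 (heavyNbr x j) + 𝟙 (light x j)
    split j with heavyNbr x j
    ... | true = ≤-trans (𝟙≤1 (j ≢ᵇ x)) (s≤s z≤n)
    ... | false = ≤-reflexive (cong 𝟙 (sym (∧-identityʳ (j ≢ᵇ x))))

  -- Local balance at an edge: the seven further edges meet x either in a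
  -- heavy vertex or in one of its  onEdge 2 x = 6 - w - r  degree-2 vertices.
  edge-balance : ∀ x → onEdge 1 x + onEdge 3 x + 1 ≤ nbrs x
  edge-balance x = +-cancelʳ-≤ (onEdge 2 x) _ _ (begin
    onEdge 1 x + onEdge 3 x + 1 + onEdge 2 x   ≡⟨ rearrange (onEdge 1 x) (onEdge 2 x) (onEdge 3 x) ⟩
    suc (onEdge 1 x + onEdge 2 x + onEdge 3 x) ≡⟨ cong suc (edge-total x) ⟩
    7                                          ≤⟨ seven x ⟩
    nbrs x + count (light x)                   ≤⟨ +-monoʳ-≤ (nbrs x) (light-count x) ⟩
    nbrs x + onEdge 2 x                        ∎)
    where
    open ≤-Reasoning
    rearrange : ∀ a b c → a + c + 1 + b ≡ suc (a + b + c)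
    rearrange a b c = solve 3 (λ a b c → a :+ c :+ con 1 :+ b := con 1 :+ (a :+ b :+ c)) refl a b c

  heavyPart : Fin 6 → Bool
  heavyPart p = incid 3 p ≡ᵇ 3

  nHeavy : ℕ
  nHeavy = count heavyPart

  incid3≡ : ∀ p → incid 3 p ≡ 𝟙 (heavyPart p) * 3
  incid3≡ p with incid3-cases p
  ... | inj₁ e rewrite e = refl
  ... | inj₂ e rewrite e = refl

  heavy⇒heavyPart : ∀ p g → heavy p g ≡ true → heavyPart p ≡ true
  heavy⇒heavyPart p g hg with incid3-cases p
  ... | inj₂ three = ≡ᵇ-intro three
  ... | inj₁ none with subst (1 ≤_) none (count-pos (heavy p) g hg)
  ... | ()

  heavyPart⇒heavy : ∀ p → heavyPart p ≡ true → ∃[ g ] heavy p g ≡ true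
  heavyPart⇒heavy p hp = count-witness (heavy p) (subst (1 ≤_) (sym (≡ᵇ-elim hp)) (s≤s z≤n))

  heavyParts-meet : ∀ p q → heavyPart p ≡ true → heavyPart q ≡ true →
    ∃[ g ] (heavy p g ≡ true × heavy q g ≡ true)
  heavyParts-meet p q hp hq with heavyPart⇒heavy p hp | heavyPart⇒heavy q hq
  ... | i , hi | j , hj with deg3-meet p i q j (heavy-deg hi) (heavy-deg hj)
  ... | g , ig , jg = g , heavy-move p i g hi ig , heavy-move q j g hj jg

  ∑-onEdge3 : ∑ (onEdge 3) ≡ nHeavy * 3
  ∑-onEdge3 = begin
    ∑ (onEdge 3)                    ≡⟨ ∑-swap (λ g p → 𝟙 (heavy p g)) ⟩
    ∑ (λ p → incid 3 p)             ≡⟨ ∑-cong incid3≡ ⟩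
    ∑ (λ p → 𝟙 (heavyPart p) * 3)   ≡⟨ ∑-*ʳ (λ p → 𝟙 (heavyPart p)) 3 ⟩
    nHeavy * 3                        ∎
    where open ≡-Reasoning

  ∑-onEdge1 : ∑ (onEdge 1) ≡ ∑ (incid 1)
  ∑-onEdge1 = ∑-swap (λ g p → 𝟙 (deg p g ≡ᵇ 1))

  -- In a heavy part 5 edges avoid the heavy vertex, and the degree-2
  -- vertices account for an even number of them.
  heavyPart-incid : ∀ p → heavyPart p ≡ true →
    (incid 1 p ≡ 1 × incid 2 p ≡ 4) ⊎ (incid 1 p ≡ 3 × incid 2 p ≡ 2) ⊎ (incid 1 p ≡ 5 × incid 2 p ≡ 0)
  heavyPart-incid p hp with deg2-even p
  ... | c , even = split c (incid 1 p) (incid 2 p) even (trans (cong (incid 1 p + incid 2 p +_) (sym (≡ᵇ-elim hp))) (incid-total p))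
    where
    split : ∀ c a b → b ≡ c * 2 → a + b + 3 ≡ 8 → (a ≡ 1 × b ≡ 4) ⊎ (a ≡ 3 × b ≡ 2) ⊎ (a ≡ 5 × b ≡ 0)
    split 0 a b refl e = inj₂ (inj₂ (+-cancelʳ-≡ 3 a 5 (trans (cong (_+ 3) (sym (+-identityʳ a))) e) , refl))
    split 1 a b refl e = inj₂ (inj₁ (+-cancelʳ-≡ 5 a 3 (trans (sym (+-assoc a 2 3)) e) , refl))
    split 2 a b refl e = inj₁ (+-cancelʳ-≡ 7 a 1 (trans (sym (+-assoc a 4 3)) e) , refl)
    split (suc (suc (suc c))) a b refl e = ⊥-elim (<-irrefl refl (begin-strict
      8                                    <⟨ s≤s (s≤s (s≤s (s≤s (s≤s (s≤s (s≤s (s≤s (s≤s z≤n)))))))) ⟩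
      9                                    ≤⟨ m≤n+m 9 (a + c * 2) ⟩
      a + c * 2 + 9                        ≡⟨ solve 2 (λ a c → a :+ c :* con 2 :+ con 9 := a :+ (con 3 :+ c) :* con 2 :+ con 3) refl a c ⟩
      a + suc (suc (suc c)) * 2 + 3        ≡⟨ e ⟩
      8                                    ∎))
      where open ≤-Reasoning

  heavyPart⇒incid1≥1 : ∀ p → heavyPart p ≡ true → 1 ≤ incid 1 p
  heavyPart⇒incid1≥1 p hp with heavyPart-incid p hp
  ... | inj₁ (e , _) = ≤-reflexive (sym e)
  ... | inj₂ (inj₁ (e , _)) = subst (1 ≤_) (sym e) (s≤s z≤n)
  ... | inj₂ (inj₂ (e , _)) = subst (1 ≤_) (sym e) (s≤s z≤n)

  -- In a part without heavy vertex incid 1 p = 8 - incid 2 p is even.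
  lightPart-incid1 : ∀ p → heavyPart p ≡ false → incid 1 p ≤ 1 → incid 1 p ≡ 0
  lightPart-incid1 p lp ≤1 with incid3-cases p
  ... | inj₂ three = ⊥-elim (true≢false (≡ᵇ-intro three) lp)
  ... | inj₁ none with deg2-even p
  ... | c , even = not-one c (incid 1 p) (incid 2 p) even (trans (cong (incid 1 p + incid 2 p +_) (sym none)) (incid-total p)) ≤1
    where
    odd≢8 : ∀ c → suc (c * 2) ≢ 8
    odd≢8 0 ()
    odd≢8 1 ()
    odd≢8 2 ()
    odd≢8 3 ()
    odd≢8 (suc (suc (suc (suc c)))) ()
    not-one : ∀ c a b → b ≡ c * 2 → a + b + 0 ≡ 8 → a ≤ 1 → a ≡ 0
    not-one c zero b _ _ _ = refl
    not-one c (suc zero) b refl e _ = ⊥-elim (odd≢8 c (trans (sym (+-identityʳ (suc (c * 2)))) e))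
    not-one c (suc (suc a)) b _ _ (s≤s ())

  -- the lower bound for  nbrs g  given by the local balance
  need : Fin 8 → ℕ
  need g = onEdge 1 g + onEdge 3 g + 1

  -- Local balance against the upper bound: w + r + 1 ≤ nbrs ≤ 2r, with
  -- slack 1 at a crowded edge.
  need≤ : ∀ g → need g ≤ onEdge 3 g * 2
  need≤ g = ≤-trans (edge-balance g) (nbrs≤ g)

  need<-crowded : ∀ x → Crowded x → need x + 1 ≤ onEdge 3 x * 2
  need<-crowded x crowded = begin
    need x + 1    ≤⟨ +-monoˡ-≤ 1 (edge-balance x) ⟩
    nbrs x + 1    ≡⟨ +-comm (nbrs x) 1 ⟩
    suc (nbrs x)  ≤⟨ crowded⇒nbrs< x crowded ⟩
    onEdge 3 x * 2 ∎
    where open ≤-Reasoning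

  heavy-on-every-edge : ∀ g → 1 ≤ onEdge 3 g
  heavy-on-every-edge g with onEdge 3 g | need≤ g
  ... | zero | need≤0 = ⊥-elim (<-irrefl refl (≤-trans (m≤n+m 1 _) need≤0))
  ... | suc _ | _ = s≤s z≤n

  nHeavy≤6 : nHeavy ≤ 6
  nHeavy≤6 = count≤ heavyPart

  heavyPart≤incid1 : ∀ p → 𝟙 (heavyPart p) ≤ incid 1 p
  heavyPart≤incid1 p with heavyPart p in hp
  ... | false = z≤n
  ... | true = heavyPart⇒incid1≥1 p hp

  nHeavy≤incid1 : nHeavy ≤ ∑ (incid 1)
  nHeavy≤incid1 = ∑-mono heavyPart≤incid1

  ∑-need : ∑ need ≡ ∑ (incid 1) + nHeavy * 3 + 8
  ∑-need = begin
    ∑ need                                       ≡⟨ ∑-+₃ (onEdge 1) (onEdge 3) (λ _ → 1) ⟩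
    ∑ (onEdge 1) + ∑ (onEdge 3) + ∑ {8} (λ _ → 1) ≡⟨ cong₂ _+_ (cong₂ _+_ ∑-onEdge1 ∑-onEdge3) (∑-const {8} 1) ⟩
    ∑ (incid 1) + nHeavy * 3 + 8                 ∎
    where open ≡-Reasoning

  ∑-twice-onEdge3 : ∑ (λ g → onEdge 3 g * 2) ≡ nHeavy * 3 * 2
  ∑-twice-onEdge3 = trans (∑-*ʳ (onEdge 3) 2) (cong (_* 2) ∑-onEdge3)

  global-balance : ∑ (incid 1) + nHeavy * 3 + 8 ≤ nHeavy * 3 * 2
  global-balance = begin
    ∑ (incid 1) + nHeavy * 3 + 8  ≡⟨ ∑-need ⟨
    ∑ need                        ≤⟨ ∑-mono need≤ ⟩
    ∑ (λ g → onEdge 3 g * 2)      ≡⟨ ∑-twice-onEdge3 ⟩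
    nHeavy * 3 * 2                ∎
    where open ≤-Reasoning

  -- With  k = nHeavy ≤ S  the global balance gives  4k + 8 ≤ 6k.
  nHeavy≥4 : 4 ≤ nHeavy
  nHeavy≥4 = check nHeavy (≤-trans (+-monoˡ-≤ 8 (+-monoˡ-≤ (nHeavy * 3) nHeavy≤incid1)) global-balance)
    where
    check : ∀ k → k + k * 3 + 8 ≤ k * 3 * 2 → 4 ≤ k
    check 0 h = ⊥-elim (numeral-absurd h _)
    check 1 h = ⊥-elim (numeral-absurd h _)
    check 2 h = ⊥-elim (numeral-absurd h _)
    check 3 h = ⊥-elim (numeral-absurd h _)
    check (suc (suc (suc (suc _)))) _ = s≤s (s≤s (s≤s (s≤s z≤n)))

  heavyPair : Fin 8 → Fin 6 → Fin 6 → Bool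
  heavyPair g p q = heavy p g ∧ heavy q g ∧ (q ≢ᵇ p)

  -- number of ordered pairs of distinct heavy vertices on the edge g
  pairsOn : Fin 8 → ℕ
  pairsOn g = onEdge 3 g * (onEdge 3 g ∸ 1)

  pairsOn≡ : ∀ g → ∑ (λ p → count (heavyPair g p)) ≡ pairsOn g
  pairsOn≡ g = trans (∑-cong row) (∑-*ʳ (λ p → 𝟙 (heavy p g)) (onEdge 3 g ∸ 1))
    where
    row : ∀ p → count (heavyPair g p) ≡ 𝟙 (heavy p g) * (onEdge 3 g ∸ 1)
    row p with heavy p g in hp
    ... | false = count-none {6} (λ _ → refl)
    ... | true = trans (cong (_∸ 1) (sym (count-remove (λ q → heavy q g) p hp))) (sym (+-identityʳ _))

  coHeavy : Fin 6 → Fin 6 → ℕ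
  coHeavy p q = count (λ g → heavyPair g p q)

  pairs-double-count : ∑ pairsOn ≡ ∑ (λ p → ∑ (λ q → coHeavy p q))
  pairs-double-count = begin
    ∑ pairsOn                                                   ≡⟨ ∑-cong pairsOn≡ ⟨
    ∑ (λ g → ∑ (λ p → count (heavyPair g p)))                 ≡⟨ ∑-swap (λ g p → count (heavyPair g p)) ⟩
    ∑ (λ p → ∑ (λ g → count (heavyPair g p)))                 ≡⟨ ∑-cong (λ p → ∑-swap (λ g q → 𝟙 (heavyPair g p q))) ⟩
    ∑ (λ p → ∑ (λ q → coHeavy p q))                           ∎
    where open ≡-Reasoning

  distinctHeavy : Fin 6 → Fin 6 → Bool
  distinctHeavy p q = heavyPart p ∧ heavyPart q ∧ (q ≢ᵇ p)

  distinctHeavy-total : ∑ (λ p → count (distinctHeavy p)) ≡ nHeavy * (nHeavy ∸ 1)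
  distinctHeavy-total = trans (∑-cong row) (∑-*ʳ (λ p → 𝟙 (heavyPart p)) (nHeavy ∸ 1))
    where
    row : ∀ p → count (distinctHeavy p) ≡ 𝟙 (heavyPart p) * (nHeavy ∸ 1)
    row p with heavyPart p in hp
    ... | false = count-none {6} (λ _ → refl)
    ... | true = trans (cong (_∸ 1) (sym (count-remove heavyPart p hp))) (sym (+-identityʳ _))

  distinctHeavy≤coHeavy : ∀ p q → 𝟙 (distinctHeavy p q) ≤ coHeavy p q
  distinctHeavy≤coHeavy p q with distinctHeavy p q in dpq
  ... | false = z≤n
  ... | true with ∧-elim {heavyPart p} dpq
  ... | hp , rest with ∧-elim {heavyPart q} rest
  ... | hq , q≢ᵇp with heavyParts-meet p q hp hq
  ... | g , hpg , hqg = count-pos (λ g → heavyPair g p q) g (∧-intro hpg (∧-intro hqg q≢ᵇp))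

  pairs≥ : nHeavy * (nHeavy ∸ 1) ≤ ∑ pairsOn
  pairs≥ = begin
    nHeavy * (nHeavy ∸ 1)                        ≡⟨ distinctHeavy-total ⟨
    ∑ (λ p → count (distinctHeavy p))          ≤⟨ ∑-mono (λ p → ∑-mono (distinctHeavy≤coHeavy p)) ⟩
    ∑ (λ p → ∑ (λ q → coHeavy p q))          ≡⟨ pairs-double-count ⟨
    ∑ pairsOn                                  ∎
    where open ≤-Reasoning

  -- If the heavy vertices of p ≠ q lie together on two edges x ≠ y, then
  -- the pair (p , q) is counted twice in both orders.
  pairs> : ∀ p q x y → p ≢ q → x ≢ y → heavy p x ≡ true → heavy p y ≡ true → heavy q x ≡ true → heavy q y ≡ true →
    nHeavy * (nHeavy ∸ 1) + 1 + 1 ≤ ∑ pairsOn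
  pairs> p q x y p≢q x≢y px py qx qy = begin
    nHeavy * (nHeavy ∸ 1) + 1 + 1                ≡⟨ cong (λ z → z + 1 + 1) distinctHeavy-total ⟨
    ∑ (λ p → count (distinctHeavy p)) + 1 + 1  ≤⟨ ∑-mono-slack₂ p q 1 1 p≢q row (twice p q p≢q px py qx qy) (twice q p q≢p qx qy px py) ⟩
    ∑ (λ p → ∑ (λ q → coHeavy p q))          ≡⟨ pairs-double-count ⟨
    ∑ pairsOn                                  ∎
    where
    open ≤-Reasoning
    q≢p : q ≢ p
    q≢p q≡p = p≢q (sym q≡p)
    row : ∀ s → count (distinctHeavy s) ≤ ∑ (coHeavy s)
    row s = ∑-mono (distinctHeavy≤coHeavy s)
    twice : ∀ s t → s ≢ t → heavy s x ≡ true → heavy s y ≡ true → heavy t x ≡ true → heavy t y ≡ true →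
      count (distinctHeavy s) + 1 ≤ ∑ (coHeavy s)
    twice s t s≢t sx sy tx ty = ∑-mono-slack t 1 (distinctHeavy≤coHeavy s) (begin
      𝟙 (distinctHeavy s t) + 1       ≤⟨ +-monoˡ-≤ 1 (𝟙≤1 (distinctHeavy s t)) ⟩
      2                               ≤⟨ count≥2 (λ g → heavyPair g s t) x y (pair sx tx) (pair sy ty) x≢y ⟩
      coHeavy s t                     ∎)
      where
      pair : ∀ {g} → heavy s g ≡ true → heavy t g ≡ true → heavyPair g s t ≡ true
      pair sg tg = ∧-intro sg (∧-intro tg (≢ᵇ-intro (λ t≡s → s≢t (sym t≡s))))

  uncrowded⇒nbrs≥ : ∀ x → ¬ Crowded x → onEdge 3 x * 2 ≤ nbrs x
  uncrowded⇒nbrs≥ x uncrowded with onEdge 3 x * 2 ≤? nbrs x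
  ... | yes ≤nbrs = ≤nbrs
  ... | no >nbrs = ⊥-elim (uncrowded (nbrs<⇒crowded x (≰⇒> >nbrs)))

  -- an uncrowded edge has at most three heavy vertices, as  2r ≤ nbrs ≤ 7
  uncrowded⇒onEdge3≤3 : ∀ x → ¬ Crowded x → onEdge 3 x ≤ 3
  uncrowded⇒onEdge3≤3 x uncrowded with onEdge 3 x ≤? 3
  ... | yes ≤3 = ≤3
  ... | no >3 = ⊥-elim (numeral-absurd (begin
      8                ≤⟨ *-monoˡ-≤ 2 (≰⇒> >3) ⟩
      onEdge 3 x * 2   ≤⟨ uncrowded⇒nbrs≥ x uncrowded ⟩
      nbrs x           ≤⟨ nbrs≤7 x ⟩
      7                ∎) _)
    where open ≤-Reasoning

  -- an edge with at most three heavy vertices has at most six heavy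
  -- neighbours, so one of the seven further edges is light
  light-edge : ∀ x → onEdge 3 x ≤ 3 → ∃[ h ] light x h ≡ true
  light-edge x r≤3 = count-witness (light x) (+-cancelˡ-≤ 6 _ _ (begin
    7                          ≤⟨ seven x ⟩
    nbrs x + count (light x)   ≤⟨ +-monoˡ-≤ _ (≤-trans (nbrs≤ x) (*-monoˡ-≤ 2 r≤3)) ⟩
    6 + count (light x)        ∎))
    where open ≤-Reasoning

  -- The heavy vertex (q , h) of a light edge h of x meets every heavy
  -- vertex (p , x) on an edge y, which is neither x (as (q , h) is not on x)
  -- nor h (as h is light).
  light-meeting : ∀ x h q p → light x h ≡ true → heavy q h ≡ true → heavy p x ≡ true →
    ∃[ y ] (via x p y ≡ true × meet q h y ≡ true × h ≢ y)
  light-meeting x h q p lh qh px with ∧-elim lh | deg3-meet p x q h (heavy-deg px) (heavy-deg qh)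
  ... | h≢ᵇx , not-nbr | y , xy , hy = y , vy , hy , h≢y
    where
    not-via : ∀ s → via x s h ≡ true → ⊥
    not-via s v = true≢false (heavyNbr-intro x s h v) (not-elim not-nbr)
    y≢x : y ≢ x
    y≢x refl = not-via q (∧-intro (heavy-move q h x qh hy) (∧-intro (meet-sym q h x hy) h≢ᵇx))
    vy : via x p y ≡ true
    vy = ∧-intro px (∧-intro xy (≢ᵇ-intro y≢x))
    h≢y : h ≢ y
    h≢y refl = not-via p vy

  -- With three,
  -- take a light edge h and its heavy vertex (q , h): it meets the three
  -- heavy vertices of x on three edges y₁, y₂, y₃ ≠ h, pairwise distinct
  -- because x is uncrowded, so (q , h) would have degree at least 4.
  uncrowded⇒onEdge3≤2 : ∀ x → ¬ Crowded x → onEdge 3 x ≤ 2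
  uncrowded⇒onEdge3≤2 x uncrowded with onEdge 3 x ≤? 2
  ... | yes ≤2 = ≤2
  ... | no >2 with count≥3⇒three (λ p → heavy p x) (≰⇒> >2) | light-edge x (uncrowded⇒onEdge3≤3 x uncrowded)
  ... | p₁ , p₂ , p₃ , h₁ , h₂ , h₃ , p₁≢p₂ , p₁≢p₃ , p₂≢p₃ | h , lh
      with count-witness (λ q → heavy q h) (heavy-on-every-edge h)
  ... | q , qh with light-meeting x h q p₁ lh qh h₁ | light-meeting x h q p₂ lh qh h₂ | light-meeting x h q p₃ lh qh h₃
  ... | y₁ , v₁ , q-y₁ , h≢y₁ | y₂ , v₂ , q-y₂ , h≢y₂ | y₃ , v₃ , q-y₃ , h≢y₃ =
    ⊥-elim (numeral-absurd (begin
      4         ≤⟨ count≥4 (meet q h) h y₁ y₂ y₃ (meet-refl q h) q-y₁ q-y₂ q-y₃ h≢y₁ h≢y₂ h≢y₃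
                     (distinct p₁≢p₂ v₁ v₂) (distinct p₁≢p₃ v₁ v₃) (distinct p₂≢p₃ v₂ v₃) ⟩
      deg q h   ≡⟨ heavy-deg qh ⟩
      3         ∎) _)
    where
    open ≤-Reasoning
    distinct : ∀ {p p′ y y′} → p ≢ p′ → via x p y ≡ true → via x p′ y′ ≡ true → y ≢ y′
    distinct p≢p′ v v′ refl = uncrowded (_ , _ , _ , p≢p′ , v , v′)

  -- Some edge is crowded.  Otherwise every edge carries one or two heavy
  -- vertices, whence  Σ pairsOn + 16 ≤ 2 Σ onEdge 3 = 6k; but
  -- k(k-1) ≤ Σ pairsOn  and  4 ≤ k ≤ 6.
  some-crowded : ∃[ x ] Crowded x
  some-crowded with all-or-counterexample (λ g → onEdge 3 g * 2 ≤ nbrs g) (λ g → onEdge 3 g * 2 ≤? nbrs g)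
  ... | inj₂ (x , >nbrs) = x , nbrs<⇒crowded x (≰⇒> >nbrs)
  ... | inj₁ linear = ⊥-elim (check nHeavy nHeavy≥4 nHeavy≤6 (begin
      nHeavy * (nHeavy ∸ 1) + 16                 ≤⟨ +-monoˡ-≤ 16 pairs≥ ⟩
      ∑ pairsOn + 16                           ≡⟨ cong (∑ pairsOn +_) (∑-const {8} 2) ⟨
      ∑ pairsOn + ∑ {8} (λ _ → 2)            ≡⟨ ∑-+ pairsOn (λ _ → 2) ⟨
      ∑ (λ g → pairsOn g + 2)                  ≤⟨ ∑-mono (λ g → small (onEdge 3 g) (heavy-on-every-edge g) (r≤2 g)) ⟩
      ∑ (λ g → onEdge 3 g * 2)                 ≡⟨ ∑-twice-onEdge3 ⟩
      nHeavy * 3 * 2                             ∎))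
    where
    open ≤-Reasoning
    r≤2 : ∀ g → onEdge 3 g ≤ 2
    r≤2 g = uncrowded⇒onEdge3≤2 g (λ crowded → <⇒≱ (crowded⇒nbrs< g crowded) (linear g))
    small : ∀ r → 1 ≤ r → r ≤ 2 → r * (r ∸ 1) + 2 ≤ r * 2
    small 1 _ _ = ≤-refl
    small 2 _ _ = ≤-refl
    small (suc (suc (suc _))) _ (s≤s (s≤s ()))
    check : ∀ k → 4 ≤ k → k ≤ 6 → ¬ (k * (k ∸ 1) + 16 ≤ k * 3 * 2)
    check 1 (s≤s ()) _ _
    check 2 (s≤s (s≤s ())) _ _
    check 3 (s≤s (s≤s (s≤s ()))) _ _
    check 4 _ _ h = numeral-absurd h _
    check 5 _ _ h = numeral-absurd h _
    check 6 _ _ h = numeral-absurd h _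
    check (suc (suc (suc (suc (suc (suc (suc _))))))) _ (s≤s (s≤s (s≤s (s≤s (s≤s (s≤s ())))))) _

  -- With a crowded edge the global balance is strict:  S + 3k + 9 ≤ 6k.
  global-balance-strict : ∑ (incid 1) + nHeavy * 3 + 8 + 1 ≤ nHeavy * 3 * 2
  global-balance-strict with some-crowded
  ... | x , crowded = begin
    ∑ (incid 1) + nHeavy * 3 + 8 + 1  ≡⟨ cong (_+ 1) ∑-need ⟨
    ∑ need + 1                        ≤⟨ ∑-mono-slack x 1 need≤ (need<-crowded x crowded) ⟩
    ∑ (λ g → onEdge 3 g * 2)          ≡⟨ ∑-twice-onEdge3 ⟩
    nHeavy * 3 * 2                    ∎
    where open ≤-Reasoning

  -- Together with  k ≤ S  and  k ≤ 6  only two cases remain.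
  nHeavy-cases : (nHeavy ≡ 6 × ∑ (incid 1) ≤ 9) ⊎ (nHeavy ≡ 5 × ∑ (incid 1) ≤ 6)
  nHeavy-cases = check nHeavy (∑ (incid 1)) nHeavy≤6 nHeavy≤incid1 global-balance-strict
    where
    check : ∀ k S → k ≤ 6 → k ≤ S → S + k * 3 + 8 + 1 ≤ k * 3 * 2 → (k ≡ 6 × S ≤ 9) ⊎ (k ≡ 5 × S ≤ 6)
    check k S k≤6 k≤S h with ≤-trans (+-monoˡ-≤ 1 (+-monoˡ-≤ 8 (+-monoˡ-≤ (k * 3) k≤S))) h
    ... | h′ with k
    ... | 0 = ⊥-elim (numeral-absurd h′ _)
    ... | 1 = ⊥-elim (numeral-absurd h′ _)
    ... | 2 = ⊥-elim (numeral-absurd h′ _)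
    ... | 3 = ⊥-elim (numeral-absurd h′ _)
    ... | 4 = ⊥-elim (numeral-absurd h′ _)
    ... | 5 = inj₂ (refl , +-cancelʳ-≤ 24 S 6 (subst (_≤ 30) (trans (+-assoc (S + 15) 8 1) (+-assoc S 15 9)) h))
    ... | 6 = inj₁ (refl , +-cancelʳ-≤ 27 S 9 (subst (_≤ 36) (trans (+-assoc (S + 18) 8 1) (+-assoc S 18 9)) h))
    ... | suc (suc (suc (suc (suc (suc (suc _)))))) = ⊥-elim (numeral-absurd k≤6 _)

  crowded-partner : ∀ x y p q → p ≢ q → via x p y ≡ true → via x q y ≡ true → Crowded y
  crowded-partner x y p q p≢q vp vq = x , p , q , p≢q , back vp , back vq
    where
    back : ∀ {s} → via x s y ≡ true → via y s x ≡ true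
    back {s} v with via-elim v
    ... | hx , xy , y≢x = ∧-intro (heavy-move s x y hx xy) (∧-intro (meet-sym s x y xy) (≢ᵇ-intro (λ x≡y → y≢x (sym x≡y))))

  ∑-onEdge3-times : ∀ c → ∑ (λ g → onEdge 3 g * c) ≡ nHeavy * 3 * c
  ∑-onEdge3-times c = trans (∑-*ʳ (onEdge 3) c) (cong (_* c) ∑-onEdge3)

  -- Five heavy parts and at most three heavy vertices per edge is impossible:
  -- a crowded edge gives  k(k-1) + 2 ≤ Σ pairsOn, while  r(r-1) + 3 ≤ 3r
  -- for 1 ≤ r ≤ 3 gives  Σ pairsOn + 24 ≤ 9k.
  five-heavy-r≤3 : nHeavy ≡ 5 → (∀ g → onEdge 3 g ≤ 3) → ⊥
  five-heavy-r≤3 five r≤3 with some-crowded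
  ... | x , y , p , q , p≢q , vp , vq with via-elim vp | via-elim vq
  ... | px , xyp , y≢x | qx , xyq , _ = numeral-absurd (subst (λ k → k * (k ∸ 1) + 1 + 1 + 24 ≤ k * 3 * 3) five (begin
      nHeavy * (nHeavy ∸ 1) + 1 + 1 + 24   ≤⟨ +-monoˡ-≤ 24 (pairs> p q x y p≢q (λ x≡y → y≢x (sym x≡y)) px (heavy-move p x y px xyp) qx (heavy-move q x y qx xyq)) ⟩
      ∑ pairsOn + 24                       ≡⟨ cong (∑ pairsOn +_) (∑-const {8} 3) ⟨
      ∑ pairsOn + ∑ {8} (λ _ → 3)          ≡⟨ ∑-+ pairsOn (λ _ → 3) ⟨
      ∑ (λ g → pairsOn g + 3)              ≤⟨ ∑-mono (λ g → small (onEdge 3 g) (heavy-on-every-edge g) (r≤3 g)) ⟩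
      ∑ (λ g → onEdge 3 g * 3)             ≡⟨ ∑-onEdge3-times 3 ⟩
      nHeavy * 3 * 3                       ∎)) _
    where
    open ≤-Reasoning
    small : ∀ r → 1 ≤ r → r ≤ 3 → r * (r ∸ 1) + 3 ≤ r * 3
    small 1 _ _ = s≤s (s≤s (s≤s z≤n))
    small 2 _ _ = s≤s (s≤s (s≤s (s≤s (s≤s z≤n))))
    small 3 _ _ = ≤-refl
    small (suc (suc (suc (suc _)))) _ (s≤s (s≤s (s≤s ())))

  -- Then x is crowded (nbrs x ≤ 7 < 2r), and so is the edge y realising
  -- this.  The light part p₀ has no degree-1 vertex, so its vertex on x
  -- has degree 2 and  w + r ≤ 5  at x, giving slack 2 at x and 1 at y in
  -- need ≤ 2r; summing,  S + 15 + 8 + 3 ≤ 30  against  S ≥ 5.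
  five-heavy-r≥4 : ∀ p₀ x → nHeavy ≡ 5 → heavyPart p₀ ≡ false → incid 1 p₀ ≡ 0 → 4 ≤ onEdge 3 x → ⊥
  five-heavy-r≥4 p₀ x five light₀ no-deg1 r≥4
    with nbrs<⇒crowded x (≤-trans (s≤s (nbrs≤7 x)) (*-monoˡ-≤ 2 r≥4))
  ... | y , p , q , p≢q , vp , vq with via-elim vp
  ... | _ , _ , y≢x = numeral-absurd (subst (λ k → k + k * 3 + 8 + 2 + 1 ≤ k * 3 * 2) five (begin
      nHeavy + nHeavy * 3 + 8 + 2 + 1      ≤⟨ +-monoˡ-≤ 1 (+-monoˡ-≤ 2 (+-monoˡ-≤ 8 (+-monoˡ-≤ (nHeavy * 3) nHeavy≤incid1))) ⟩
      ∑ (incid 1) + nHeavy * 3 + 8 + 2 + 1 ≡⟨ cong (λ z → z + 2 + 1) ∑-need ⟨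
      ∑ need + 2 + 1                       ≤⟨ ∑-mono-slack₂ x y 2 1 (λ x≡y → y≢x (sym x≡y)) need≤ slack-x
                                                 (need<-crowded y (crowded-partner x y p q p≢q vp vq)) ⟩
      ∑ (λ g → onEdge 3 g * 2)             ≡⟨ ∑-twice-onEdge3 ⟩
      nHeavy * 3 * 2                       ∎)) _
    where
    open ≤-Reasoning
    one-of-13 : ∀ v → 𝟙 (v ≡ᵇ 1) + 𝟙 (v ≡ᵇ 3) ≤ 1
    one-of-13 0 = z≤n
    one-of-13 1 = ≤-refl
    one-of-13 2 = z≤n
    one-of-13 3 = ≤-refl
    one-of-13 (suc (suc (suc (suc v)))) = z≤n
    -- only the five parts other than p₀ contribute to w and r at x
    w+r≤5 : onEdge 1 x + onEdge 3 x ≤ 5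
    w+r≤5 = begin
      onEdge 1 x + onEdge 3 x                          ≡⟨ ∑-+ (λ s → 𝟙 (deg s x ≡ᵇ 1)) (λ s → 𝟙 (deg s x ≡ᵇ 3)) ⟨
      ∑ (λ s → 𝟙 (deg s x ≡ᵇ 1) + 𝟙 (deg s x ≡ᵇ 3))   ≤⟨ ∑-mono other-parts ⟩
      count (λ s → s ≢ᵇ p₀)                            ≡⟨ count-others p₀ ⟩
      5                                                ∎
      where
      other-parts : ∀ s → 𝟙 (deg s x ≡ᵇ 1) + 𝟙 (deg s x ≡ᵇ 3) ≤ 𝟙 (s ≢ᵇ p₀)
      other-parts s with s ≟ p₀
      ... | no _ = one-of-13 (deg s x)
      ... | yes refl with deg p₀ x ≡ᵇ 1 in d1 | heavy p₀ x in h3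
      ... | false | false = z≤n
      ... | true | _ = ⊥-elim (true≢false d1 (count-zero⇒false (λ i → deg p₀ i ≡ᵇ 1) no-deg1 x))
      ... | false | true = ⊥-elim (true≢false (heavy⇒heavyPart p₀ x h3) light₀)
    slack-x : need x + 2 ≤ onEdge 3 x * 2
    slack-x = begin
      onEdge 1 x + onEdge 3 x + 1 + 2  ≤⟨ +-monoˡ-≤ 2 (+-monoˡ-≤ 1 w+r≤5) ⟩
      8                                ≤⟨ *-monoˡ-≤ 2 r≥4 ⟩
      onEdge 3 x * 2                   ∎

  light-part : nHeavy ≡ 5 → ∃[ p₀ ] heavyPart p₀ ≡ false
  light-part five with count-witness (λ p → not (heavyPart p)) (≤-reflexive (sym one-light))
    where
    one-light : count (λ p → not (heavyPart p)) ≡ 1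
    one-light = +-cancelˡ-≡ 5 _ _ (trans (cong (_+ count (λ p → not (heavyPart p))) (sym five)) (count-compl heavyPart))
  ... | p₀ , light₀ = p₀ , not-elim light₀

  -- ... and, when S ≤ 6, has no vertex of degree 1 (as each heavy part has one)
  light-part-no-deg1 : ∀ p₀ → nHeavy ≡ 5 → ∑ (incid 1) ≤ 6 → heavyPart p₀ ≡ false → incid 1 p₀ ≡ 0
  light-part-no-deg1 p₀ five S≤6 light₀ = lightPart-incid1 p₀ light₀ (+-cancelˡ-≤ 5 _ _ (begin
    5 + incid 1 p₀            ≡⟨ cong (_+ incid 1 p₀) five ⟨
    nHeavy + incid 1 p₀       ≤⟨ ∑-mono-slack p₀ (incid 1 p₀) heavyPart≤incid1 (≤-reflexive (cong (λ b → 𝟙 b + incid 1 p₀) light₀)) ⟩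
    ∑ (incid 1)               ≤⟨ S≤6 ⟩
    6                         ∎))
    where open ≤-Reasoning

  not-five-heavy : nHeavy ≡ 5 → ∑ (incid 1) ≤ 6 → ⊥
  not-five-heavy five S≤6 with light-part five | all-or-counterexample (λ g → onEdge 3 g ≤ 3) (λ g → onEdge 3 g ≤? 3)
  ... | _ | inj₁ r≤3 = five-heavy-r≤3 five r≤3
  ... | p₀ , light₀ | inj₂ (x , r>3) =
    five-heavy-r≥4 p₀ x five light₀ (light-part-no-deg1 p₀ five S≤6 light₀) (≰⇒> r>3)

  -- the two degree profiles of a part, counted by incidences
  ProfileA ProfileB : Fin 6 → Set
  ProfileA p = incid 3 p ≡ 3 × incid 2 p ≡ 4 × incid 1 p ≡ 1
  ProfileB p = incid 3 p ≡ 3 × incid 2 p ≡ 2 × incid 1 p ≡ 3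

  -- With six heavy parts every part has  incid 1 ∈ {1, 3, 5}, and S ≤ 9
  -- leaves room for at most one part with incid 1 ≠ 1, where it is 3.
  module SixHeavyParts (six : nHeavy ≡ 6) where

    all-heavy : ∀ p → heavyPart p ≡ true
    all-heavy p with heavyPart p in hp
    ... | true = refl
    ... | false = ⊥-elim (true≢false (cong not hp) (count-zero⇒false (λ p → not (heavyPart p)) no-light p))
      where
      no-light : count (λ p → not (heavyPart p)) ≡ 0
      no-light = +-cancelˡ-≡ 6 _ _ (trans (cong (_+ count (λ p → not (heavyPart p))) (sym six)) (count-compl heavyPart))

    profileA : ∀ p → incid 1 p ≡ 1 → ProfileA p
    profileA p e with heavyPart-incid p (all-heavy p)
    ... | inj₁ (_ , e₂) = ≡ᵇ-elim (all-heavy p) , e₂ , e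
    ... | inj₂ (inj₁ (e₁ , _)) = ⊥-elim (numeral-absurd (≤-reflexive (trans (sym e₁) e)) _)
    ... | inj₂ (inj₂ (e₁ , _)) = ⊥-elim (numeral-absurd (≤-reflexive (trans (sym e₁) e)) _)

    at-least-one : ∀ p → 1 ≤ incid 1 p
    at-least-one p = heavyPart⇒incid1≥1 p (all-heavy p)

    at-least-three : ∀ p → incid 1 p ≢ 1 → 1 + 2 ≤ incid 1 p
    at-least-three p ≢1 with heavyPart-incid p (all-heavy p)
    ... | inj₁ (e , _) = ⊥-elim (≢1 e)
    ... | inj₂ (inj₁ (e , _)) = ≤-reflexive (sym e)
    ... | inj₂ (inj₂ (e , _)) = subst (3 ≤_) (sym e) (s≤s (s≤s (s≤s z≤n)))

    six-heavy : ∑ (incid 1) ≤ 9 → (∀ p → ProfileA p) ⊎ ∃[ p ] (ProfileB p × ∀ q → q ≢ p → ProfileA q)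
    six-heavy S≤9 with all-or-counterexample (λ p → incid 1 p ≡ 1) (λ p → incid 1 p ≟ℕ 1)
    ... | inj₁ all-one = inj₁ λ p → profileA p (all-one p)
    ... | inj₂ (p , p≢1) = inj₂ (p , profileB , others)
      where
      open ≤-Reasoning
      profileB : ProfileB p
      profileB with heavyPart-incid p (all-heavy p)
      ... | inj₁ (e , _) = ⊥-elim (p≢1 e)
      ... | inj₂ (inj₁ (e₁ , e₂)) = ≡ᵇ-elim (all-heavy p) , e₂ , e₁
      ... | inj₂ (inj₂ (e₁ , _)) = ⊥-elim (numeral-absurd (begin
          6 + 4                          ≡⟨ cong (_+ 4) (∑-const {6} 1) ⟨
          ∑ {6} (λ _ → 1) + 4            ≤⟨ ∑-mono-slack p 4 at-least-one (≤-reflexive (sym e₁)) ⟩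
          ∑ (incid 1)                    ≤⟨ S≤9 ⟩
          9                              ∎) _)
      others : ∀ q → q ≢ p → ProfileA q
      others q q≢p with incid 1 q ≟ℕ 1
      ... | yes q≡1 = profileA q q≡1
      ... | no q≢1 = ⊥-elim (numeral-absurd (begin
          6 + 2 + 2                      ≡⟨ cong (λ z → z + 2 + 2) (∑-const {6} 1) ⟨
          ∑ {6} (λ _ → 1) + 2 + 2        ≤⟨ ∑-mono-slack₂ q p 2 2 q≢p at-least-one (at-least-three q q≢1) (at-least-three p p≢1) ⟩
          ∑ (incid 1)                    ≤⟨ S≤9 ⟩
          9                              ∎) _)

  classification : (∀ p → ProfileA p) ⊎ ∃[ p ] (ProfileB p × ∀ q → q ≢ p → ProfileA q)
  classification with nHeavy-cases
  ... | inj₂ (five , S≤6) = ⊥-elim (not-five-heavy five S≤6)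
  ... | inj₁ (six , S≤9) = SixHeavyParts.six-heavy six S≤9

∣p∪q∣≤∣p∣+∣q∣ : ∀ {n} (p q : Subset n) → ∣ p ∪ q ∣ ≤ ∣ p ∣ + ∣ q ∣
∣p∪q∣≤∣p∣+∣q∣ [] [] = z≤n
∣p∪q∣≤∣p∣+∣q∣ (inside ∷ p) (inside ∷ q) = s≤s (≤-trans (∣p∪q∣≤∣p∣+∣q∣ p q) (≤-trans (m≤n+m _ 1) (≤-reflexive (sym (+-suc _ _)))))
∣p∪q∣≤∣p∣+∣q∣ (inside ∷ p) (outside ∷ q) = s≤s (∣p∪q∣≤∣p∣+∣q∣ p q)
∣p∪q∣≤∣p∣+∣q∣ (outside ∷ p) (inside ∷ q) = ≤-trans (s≤s (∣p∪q∣≤∣p∣+∣q∣ p q)) (≤-reflexive (sym (+-suc _ _)))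
∣p∪q∣≤∣p∣+∣q∣ (outside ∷ p) (outside ∷ q) = ∣p∪q∣≤∣p∣+∣q∣ p q

module FromHypergraph (n : ℕ) (E : Edges n 8) (part : Fin n → Fin 6)
  (inter : Intersecting E) (kp : IsKPartition 6 E part) (tau : Tau≡ E 4) where

  vertex : Fin 6 → Fin 8 → Fin n
  vertex p i = proj₁ (kp i p)

  vertex∈ : ∀ p i → vertex p i ∈ E i
  vertex∈ p i = proj₁ (proj₁ (proj₂ (kp i p)))

  vertex-part : ∀ p i → part (vertex p i) ≡ p
  vertex-part p i = proj₂ (proj₁ (proj₂ (kp i p)))

  vertex-unique : ∀ p i {v} → v ∈ E i → part v ≡ p → vertex p i ≡ v
  vertex-unique p i v∈ pv = proj₂ (proj₂ (kp i p)) (v∈ , pv)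

  ∈⇔vertex : ∀ {v} j → (v ∈ E j → vertex (part v) j ≡ v) × (vertex (part v) j ≡ v → v ∈ E j)
  ∈⇔vertex {v} j = (λ v∈ → vertex-unique (part v) j v∈ refl) , (λ e → subst (_∈ E j) e (vertex∈ (part v) j))

  meet : Fin 6 → Fin 8 → Fin 8 → Bool
  meet p i j = ⌊ vertex p i ≟ vertex p j ⌋

  meet-refl : ∀ p i → meet p i i ≡ true
  meet-refl p i = dec-intro (vertex p i ≟ vertex p i) refl

  meet-sym : ∀ p i j → meet p i j ≡ true → meet p j i ≡ true
  meet-sym p i j e = dec-intro (vertex p j ≟ vertex p i) (sym (dec-elim (vertex p i ≟ vertex p j) e))

  meet-trans : ∀ p i j l → meet p i j ≡ true → meet p j l ≡ true → meet p i l ≡ true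
  meet-trans p i j l e₁ e₂ = dec-intro (vertex p i ≟ vertex p l)
    (trans (dec-elim (vertex p i ≟ vertex p j) e₁) (dec-elim (vertex p j ≟ vertex p l) e₂))

  meet≡∈ : ∀ p i j → meet p i j ≡ ⌊ vertex p i ∈? E j ⌋
  meet≡∈ p i j = bool-ext
    (λ e → dec-intro (vertex p i ∈? E j) (subst (_∈ E j) (sym (dec-elim (vertex p i ≟ vertex p j) e)) (vertex∈ p j)))
    (λ e → dec-intro (vertex p i ≟ vertex p j) (sym (vertex-unique p j (dec-elim (vertex p i ∈? E j) e) (vertex-part p i))))

  on-edge : ∀ p i j → meet p i j ≡ true → vertex p i ∈ E j
  on-edge p i j e = dec-elim (vertex p i ∈? E j) (trans (sym (meet≡∈ p i j)) e)

  intersecting : ∀ i j → ∃[ p ] meet p i j ≡ true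
  intersecting i j with inter i j
  ... | v , v∈ with x∈p∩q⁻ (E i) (E j) v∈
  ... | vi , vj = part v , dec-intro (vertex (part v) i ≟ vertex (part v) j)
                     (trans (vertex-unique (part v) i vi refl) (sym (vertex-unique (part v) j vj refl)))

  no-3-cover : ∀ p₁ i₁ p₂ i₂ p₃ i₃ → (∀ j → (meet p₁ i₁ j ∨ meet p₂ i₂ j ∨ meet p₃ i₃ j) ≡ true) → ⊥
  no-3-cover p₁ i₁ p₂ i₂ p₃ i₃ covers = <-irrefl refl (≤-trans (proj₂ tau C C-covers) C≤3)
    where
    a = vertex p₁ i₁
    b = vertex p₂ i₂
    c = vertex p₃ i₃
    C : Subset n
    C = ⁅ a ⁆ ∪ (⁅ b ⁆ ∪ ⁅ c ⁆)
    C≤3 : ∣ C ∣ ≤ 3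
    C≤3 = ≤-trans (∣p∪q∣≤∣p∣+∣q∣ ⁅ a ⁆ _) (≤-trans (+-mono-≤ (≤-reflexive (∣⁅x⁆∣≡1 a)) (∣p∪q∣≤∣p∣+∣q∣ ⁅ b ⁆ ⁅ c ⁆))
             (≤-reflexive (cong₂ (λ x y → 1 + (x + y)) (∣⁅x⁆∣≡1 b) (∣⁅x⁆∣≡1 c))))
    C-covers : IsCover E C
    C-covers j with ∨-elim {meet p₁ i₁ j} (covers j)
    ... | inj₁ e = a , x∈p∩q⁺ (on-edge p₁ i₁ j e , x∈p∪q⁺ (inj₁ (x∈⁅x⁆ a)))
    ... | inj₂ e′ with ∨-elim {meet p₂ i₂ j} e′
    ... | inj₁ e = b , x∈p∩q⁺ (on-edge p₂ i₂ j e , x∈p∪q⁺ (inj₂ (x∈p∪q⁺ (inj₁ (x∈⁅x⁆ b)))))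
    ... | inj₂ e = c , x∈p∩q⁺ (on-edge p₃ i₃ j e , x∈p∪q⁺ (inj₂ (x∈p∪q⁺ (inj₂ (x∈⁅x⁆ c)))))

  degree-as-count : ∀ v → degree E v ≡ count (λ i → ⌊ v ∈? E i ⌋)
  degree-as-count v = length-filter-tabulate (λ i → v ∈? E i) (λ i → i)

  degree-by-vertex : ∀ p v → part v ≡ p → count (λ i → ⌊ vertex p i ≟ v ⌋) ≡ degree E v
  degree-by-vertex p v refl = trans (count-cong same) (sym (degree-as-count v))
    where
    same : ∀ i → ⌊ vertex (part v) i ≟ v ⌋ ≡ ⌊ v ∈? E i ⌋
    same i = bool-ext
      (λ e → dec-intro (v ∈? E i) (proj₂ (∈⇔vertex i) (dec-elim (vertex (part v) i ≟ v) e)))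
      (λ e → dec-intro (vertex (part v) i ≟ v) (proj₁ (∈⇔vertex i) (dec-elim (v ∈? E i) e)))

  deg≡degree : ∀ p i → count (meet p i) ≡ degree E (vertex p i)
  deg≡degree p i = trans (count-cong (meet≡∈ p i)) (sym (degree-as-count (vertex p i)))

  -- Counting edges by vertices: each degree-k vertex of part p lies on k edges.
  incid≡countDeg : ∀ p k → count (λ i → count (meet p i) ≡ᵇ k) ≡ countDeg E part p k * k
  incid≡countDeg p k = begin
    count (λ i → count (meet p i) ≡ᵇ k)                                   ≡⟨ ∑-cong (λ i → trans (cong 𝟙 (is-k i)) (sym (∑-delta (vertex p i) g))) ⟩
    ∑ (λ i → ∑ (λ v → 𝟙 ⌊ vertex p i ≟ v ⌋ * g v))                ≡⟨ ∑-swap (λ i v → 𝟙 ⌊ vertex p i ≟ v ⌋ * g v) ⟩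
    ∑ (λ v → ∑ (λ i → 𝟙 ⌊ vertex p i ≟ v ⌋ * g v))                ≡⟨ ∑-cong (λ v → ∑-*ʳ (λ i → 𝟙 ⌊ vertex p i ≟ v ⌋) (g v)) ⟩
    ∑ (λ v → count (λ i → ⌊ vertex p i ≟ v ⌋) * g v)              ≡⟨ ∑-cong weight ⟩
    ∑ (λ v → g v * k)                                            ≡⟨ ∑-*ʳ g k ⟩
    count (λ v → ⌊ P? v ⌋) * k                                   ≡⟨ cong (_* k) (length-filter-tabulate P? (λ v → v)) ⟨
    countDeg E part p k * k                                      ∎
    where
    open ≡-Reasoning
    P? = λ v → (part v ≟ p) ×-dec (degree E v ≟ℕ k)
    g : Fin n → ℕ
    g v = 𝟙 ⌊ P? v ⌋
    is-k : ∀ i → (count (meet p i) ≡ᵇ k) ≡ ⌊ P? (vertex p i) ⌋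
    is-k i = bool-ext
      (λ e → dec-intro (P? (vertex p i)) (vertex-part p i , trans (sym (deg≡degree p i)) (≡ᵇ-elim e)))
      (λ e → ≡ᵇ-intro (trans (deg≡degree p i) (proj₂ (dec-elim (P? (vertex p i)) e))))
    weight : ∀ v → count (λ i → ⌊ vertex p i ≟ v ⌋) * g v ≡ g v * k
    weight v with P? v
    ... | yes (pv , dv) = trans (*-identityʳ _) (trans (degree-by-vertex p v pv) (trans dv (sym (+-identityʳ k))))
    ... | no _ = *-zeroʳ (count (λ i → ⌊ vertex p i ≟ v ⌋))

  -- each degree-2 vertex of a part lies on two edges
  deg2-even : ∀ p → ∃[ c ] count (λ i → count (meet p i) ≡ᵇ 2) ≡ c * 2
  deg2-even p = countDeg E part p 2 , incid≡countDeg p 2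

  open Configuration meet meet-refl meet-sym meet-trans intersecting no-3-cover deg2-even
    using (ProfileA; ProfileB; classification)

  vertices : ∀ p k c → .{{_ : NonZero k}} → count (λ i → count (meet p i) ≡ᵇ k) ≡ c * k → countDeg E part p k ≡ c
  vertices p k c e = *-cancelʳ-≡ _ c k (trans (sym (incid≡countDeg p k)) e)

  typeA : ∀ p → ProfileA p → TypeA E part p
  typeA p (e₃ , e₂ , e₁) = vertices p 3 1 e₃ , vertices p 2 2 e₂ , vertices p 1 1 e₁
  typeB : ∀ p → ProfileB p → TypeB E part p
  typeB p (e₃ , e₂ , e₁) = vertices p 3 1 e₃ , vertices p 2 1 e₂ , vertices p 1 3 e₁
  degree-types : (∀ p → TypeA E part p) ⊎ ∃[ p ] (TypeB E part p × (∀ q → q ≢ p → TypeA E part q))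
  degree-types = ⊎-map (λ all-A p → typeA p (all-A p))
                              (λ { (p , B , others-A) → p , typeB p B , λ q q≢p → typeA q (others-A q q≢p) })
                              classification

lemma2 : ∀ (n : ℕ) (E : Edges n 8) (part : Fin n → Fin 6) →
    Distinct E → Intersecting E → IsKPartition 6 E part → Tau≡ E 4 →
    (∀ (p : Fin 6) → TypeA E part p) ⊎
    (∃[ p ] (TypeB E part p × (∀ (q : Fin 6) → q ≢ p → TypeA E part q)))
lemma2 n E part _ inter kp tau = FromHypergraph.degree-types n E part inter kp tau
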